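{- For a point $P\in\mathrm{PG}(3,q^2)\setminus\Sigma$, the following are equivalent: (i) $P$ lies on an extended line of $\Sigma$ external to $\mathcal Q_0$; (ii) $P$ is not on any extended $\mathcal Q_0$-tangent plane.
   Context: Let $q$ be an odd prime power; points of $\mathrm{PG}(3,q^2)$ are $\langle(\alpha,\beta,\gamma,\delta)\rangle$. $\Sigma=\{\langle(\alpha,\beta,\beta^q,\alpha^q)\rangle\}$ is a Baer subgeometry $\cong\mathrm{PG}(3,q)$, and $\mathcal Q_0$ is the hyperbolic quadric of $\Sigma$ given by $\alpha\delta-\beta\gamma=0$. An extended line (plane) of $\Sigma$ is the line (plane) of $\mathrm{PG}(3,q^2)$ spanned by a line (plane) of $\Sigma$; an extended line of $\Sigma$ is external to $\mathcal Q_0$ if the corresponding line of $\Sigma$ contains no point of $\mathcal Q_0$. An extended $\mathcal Q_0$-tangent plane is the extension of the tangent plane (in $\Sigma$) to $\mathcal Q_0$ at one of its points. -}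

module Defs where

open import Level using (_⊔_)
open import Algebra.Bundles using (CommutativeRing)
open import Data.Nat using (ℕ; zero; suc; _^_)
open import Data.Nat.Primality using (Prime)
open import Data.Fin using (Fin)
open import Data.Product using (Σ; ∃; ∃-syntax; _×_; _,_)
open import Relation.Nullary using (¬_)
open import Relation.Binary.PropositionalEquality using (_≡_)

OddPrimePower : ℕ → Set
OddPrimePower q = ∃[ p ] ∃[ k ] (Prime p × ¬ (p ≡ 2) × q ≡ p ^ suc k)

module _ {c ℓ} (F : CommutativeRing c ℓ) where
  open CommutativeRing F

  IsFieldCR : Set (c ⊔ ℓ)
  IsFieldCR = (¬ (0# ≈ 1#)) × (∀ x → ¬ (x ≈ 0#) → ∃[ y ] (x * y ≈ 1#))

  HasSize : ℕ → Set (c ⊔ ℓ)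
  HasSize n = Σ (Fin n → Carrier) λ enum →
                (∀ x → ∃[ i ] (enum i ≈ x)) × (∀ i j → enum i ≈ enum j → i ≡ j)

module Geometry {c ℓ} (F : CommutativeRing c ℓ) (q : ℕ) where
  open CommutativeRing F

  pow : Carrier → ℕ → Carrier
  pow x zero    = 1#
  pow x (suc n) = x * pow x n

  frob : Carrier → Carrier
  frob x = pow x q

  -- vectors of F^4, representing points of PG(3,q^2)
  V : Set c
  V = Carrier × Carrier × Carrier × Carrier

  _≈₄_ : V → V → Set ℓ
  (x0 , x1 , x2 , x3) ≈₄ (y0 , y1 , y2 , y3) = (x0 ≈ y0) × (x1 ≈ y1) × (x2 ≈ y2) × (x3 ≈ y3)

  _•_ : Carrier → V → V
  l • (x0 , x1 , x2 , x3) = (l * x0 , l * x1 , l * x2 , l * x3)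

  _⊕_ : V → V → V
  (x0 , x1 , x2 , x3) ⊕ (y0 , y1 , y2 , y3) = (x0 + y0 , x1 + y1 , x2 + y2 , x3 + y3)

  𝟎 : V
  𝟎 = (0# , 0# , 0# , 0#)

  NonZeroV : V → Set ℓ
  NonZeroV v = ¬ (v ≈₄ 𝟎)

  σvec : Carrier → Carrier → V
  σvec a b = (a , b , frob b , frob a)

  InΣ : V → Set (c ⊔ ℓ)
  InΣ v = ∃[ a ] ∃[ b ] (¬ ((a ≈ 0#) × (b ≈ 0#)) ×
            ∃[ l ] (¬ (l ≈ 0#) × v ≈₄ (l • σvec a b)))

  Qf : V → Carrier
  Qf (x0 , x1 , x2 , x3) = x0 * x3 - x1 * x2

  Bf : V → V → Carrier
  Bf (x0 , x1 , x2 , x3) (y0 , y1 , y2 , y3) =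
    ((x0 * y3 + x3 * y0) - x1 * y2) - x2 * y1

  OnQ0 : V → Set (c ⊔ ℓ)
  OnQ0 v = InΣ v × (Qf v ≈ 0#)

  Indep2 : V → V → Set (c ⊔ ℓ)
  Indep2 u v = ∀ l m → ((l • u) ⊕ (m • v)) ≈₄ 𝟎 → (l ≈ 0#) × (m ≈ 0#)

  Indep3 : V → V → V → Set (c ⊔ ℓ)
  Indep3 u v w = ∀ l m n → (((l • u) ⊕ (m • v)) ⊕ (n • w)) ≈₄ 𝟎 →
                   (l ≈ 0#) × (m ≈ 0#) × (n ≈ 0#)

  InSpan2 : V → V → V → Set (c ⊔ ℓ)
  InSpan2 x u v = ∃[ l ] ∃[ m ] (x ≈₄ ((l • u) ⊕ (m • v)))

  InSpan3 : V → V → V → V → Set (c ⊔ ℓ)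
  InSpan3 x u v w = ∃[ l ] ∃[ m ] ∃[ n ] (x ≈₄ (((l • u) ⊕ (m • v)) ⊕ (n • w)))

  -- (i) P lies on an extended line of Σ (spanned by two distinct points u, v of Σ)
  -- whose Σ-line contains no point of Q0
  OnExtExternalLine : V → Set (c ⊔ ℓ)
  OnExtExternalLine P =
    ∃[ u ] ∃[ v ] (InΣ u × InΣ v × Indep2 u v × InSpan2 P u v ×
                   (∀ z → InΣ z → InSpan2 z u v → ¬ OnQ0 z))

  InTangentΣ : V → V → Set (c ⊔ ℓ)
  InTangentΣ r x = InΣ x × (Bf r x ≈ 0#)

  -- (ii)' P lies on some extended Q0-tangent plane: the plane of PG(3,q^2)
  -- spanned by three non-collinear points of the tangent plane at r ∈ Q0
  OnExtTangentPlane : V → Set (c ⊔ ℓ)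
  OnExtTangentPlane P =
    ∃[ r ] (OnQ0 r × ∃[ x ] ∃[ y ] ∃[ z ]
      (InTangentΣ r x × InTangentΣ r y × InTangentΣ r z ×
       Indep3 x y z × InSpan3 P x y z))

{-# OPTIONS --safe #-}
-- Write x̄ = frob x = x ^ q.  In a field of order q² this is an involutive automorphism with fixed
-- field GF(q) (binomial theorem in characteristic p, x ^ (q * q) = x, and x ^ q - x has at most q
-- roots).  The points of Σ are the σvec a b = (a , b , b̄ , ā); such a point lies on Q0 iff a ā = b b̄,
-- and Bf takes values in GF(q) on Σ.
--
-- (i ⇒ ¬ ii) Let P = A u + M v with u, v on an external line of Σ, and suppose P lies on the extended
-- tangent plane at r ∈ Q0, so A s + M t = 0 with s = Bf r u, t = Bf r v in GF(q).  If (s , t) ≠ 0 then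
-- (A , M) is proportional to the GF(q)-pair (t , - s), which puts P in Σ.  Otherwise the line uv lies
-- in the tangent plane at r and meets the generator of Q0 through r.
--
-- (¬ ii ⇒ i) For P ∉ Σ the points U = P + P̄ and W = ε P + ε̄ P̄ of Σ (P̄ the conjugate vector, ε ∉ GF(q))
-- span a line through P; U and W are independent by Hilbert 90.  Were a point z of Q0 on that line, a
-- suitable point r of the generator through z would have U, W, and hence P, in its tangent plane.
module Submission where

open import Level using (_⊔_)
open import Algebra.Bundles using (CommutativeRing; CommutativeMonoid)
open import Algebra.Solver.Ring.AlmostCommutativeRing using (fromCommutativeRing; _-Raw-AlmostCommutative⟶_)
open import Data.Empty using (⊥-elim)
open import Data.Fin as Fin using (Fin; zero; suc; toℕ; fromℕ)
import Data.Fin.Properties as Fin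
open import Data.Fin.Permutation using (Permutation; permutation)
open import Data.Integer as ℤ using (ℤ; +_; -[1+_]; sign; ∣_∣; _◃_; _⊖_)
import Data.Integer.Properties as ℤ
open import Data.Maybe using (Maybe; just; nothing)
open import Data.Nat as ℕ using (ℕ; zero; suc)
import Data.Nat.Properties as ℕ
open import Data.Nat.Combinatorics using (nCn≡1)
open import Data.Nat.Divisibility using (_∣_; divides)
open import Data.Nat.Primality using (Prime; prime⇒nonTrivial)
open import Data.Product using (∃; ∃-syntax; _×_; _,_; proj₁; proj₂)
open import Data.Sign as Sign using (Sign)
open import Data.Vec using (Vec; []; _∷_; replicate)
open import Function using (_∘_)
open import Relation.Binary.Definitions using (Decidable)
open import Relation.Binary.PropositionalEquality as P using (_≡_; _≢_)
open import Relation.Nullary using (¬_; Dec; yes; no)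
open import Relation.Nullary.Decidable using (_×-dec_)
open import Defs

-- Algebra.Solver.Ring with integer coefficients, which embed into every commutative ring.
module IntegerCoefficientSolver {c ℓ} (R : CommutativeRing c ℓ) where
  open CommutativeRing R
  open import Algebra.Properties.Ring ring using (-‿involutive; -‿distribˡ-*; -‿distribʳ-*; -0#≈0#; -‿+-comm)
  open import Algebra.Properties.Semiring.Mult.TCOptimised semiring using (1+×; ×-homo-+; ×1-homo-*) renaming (_×_ to _·_)
  open import Relation.Binary.Reasoning.Setoid setoid

  signed : Sign → Carrier → Carrier
  signed Sign.+ x = x
  signed Sign.- x = - x

  signed-cong : ∀ s {x y} → x ≈ y → signed s x ≈ signed s y
  signed-cong Sign.+ x≈y = x≈y
  signed-cong Sign.- x≈y = -‿cong x≈y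

  signed-* : ∀ s t x y → signed (s Sign.* t) (x * y) ≈ signed s x * signed t y
  signed-* Sign.+ Sign.+ x y = refl
  signed-* Sign.+ Sign.- x y = -‿distribʳ-* x y
  signed-* Sign.- Sign.+ x y = -‿distribˡ-* x y
  signed-* Sign.- Sign.- x y = begin
    x * y             ≈⟨ -‿involutive (x * y) ⟨
    - - (x * y)       ≈⟨ -‿cong (-‿distribʳ-* x y) ⟩
    - (x * - y)       ≈⟨ -‿distribˡ-* x (- y) ⟩
    - x * - y         ∎

  fromℤ : ℤ → Carrier
  fromℤ (+ n)    = n · 1#
  fromℤ -[1+ n ] = - (suc n · 1#)

  fromℤ-signed : ∀ i → fromℤ i ≈ signed (sign i) (∣ i ∣ · 1#)
  fromℤ-signed (+ n)    = refl
  fromℤ-signed -[1+ n ] = refl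

  fromℤ-◃ : ∀ s n → fromℤ (s ◃ n) ≈ signed s (n · 1#)
  fromℤ-◃ Sign.+ zero    = refl
  fromℤ-◃ Sign.- zero    = sym -0#≈0#
  fromℤ-◃ Sign.+ (suc n) = refl
  fromℤ-◃ Sign.- (suc n) = refl

  fromℤ-* : ∀ i j → fromℤ (i ℤ.* j) ≈ fromℤ i * fromℤ j
  fromℤ-* i j = begin
    fromℤ (sign i Sign.* sign j ◃ ∣ i ∣ ℕ.* ∣ j ∣)             ≈⟨ fromℤ-◃ (sign i Sign.* sign j) (∣ i ∣ ℕ.* ∣ j ∣) ⟩
    signed (sign i Sign.* sign j) ((∣ i ∣ ℕ.* ∣ j ∣) · 1#)        ≈⟨ signed-cong (sign i Sign.* sign j) (×1-homo-* ∣ i ∣ ∣ j ∣) ⟩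
    signed (sign i Sign.* sign j) ((∣ i ∣ · 1#) * (∣ j ∣ · 1#))   ≈⟨ signed-* (sign i) (sign j) _ _ ⟩
    signed (sign i) (∣ i ∣ · 1#) * signed (sign j) (∣ j ∣ · 1#)   ≈⟨ *-cong (fromℤ-signed i) (fromℤ-signed j) ⟨
    fromℤ i * fromℤ j                                              ∎

  [d+a]-[d+b]≈a-b : ∀ d a b → (d + a) - (d + b) ≈ a - b
  [d+a]-[d+b]≈a-b d a b = begin
    (d + a) - (d + b)        ≈⟨ +-congˡ (-‿+-comm d b) ⟨
    (d + a) + (- d + - b)    ≈⟨ +-congʳ (+-comm d a) ⟩
    (a + d) + (- d + - b)    ≈⟨ +-assoc a d _ ⟩
    a + (d + (- d + - b))    ≈⟨ +-congˡ (+-assoc d (- d) (- b)) ⟨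
    a + ((d - d) + - b)      ≈⟨ +-congˡ (+-congʳ (-‿inverseʳ d)) ⟩
    a + (0# + - b)           ≈⟨ +-congˡ (+-identityˡ (- b)) ⟩
    a - b                    ∎

  fromℤ-⊖ : ∀ m n → fromℤ (m ⊖ n) ≈ m · 1# - n · 1#
  fromℤ-⊖ m zero = begin
    m · 1#             ≈⟨ +-identityʳ (m · 1#) ⟨
    m · 1# + 0#        ≈⟨ +-congˡ -0#≈0# ⟨
    m · 1# - 0#        ∎
  fromℤ-⊖ zero (suc n) = sym (+-identityˡ _)
  fromℤ-⊖ (suc m) (suc n) = begin
    fromℤ (suc m ⊖ suc n)                ≡⟨ P.cong fromℤ (ℤ.[1+m]⊖[1+n]≡m⊖n m n) ⟩
    fromℤ (m ⊖ n)                        ≈⟨ fromℤ-⊖ m n ⟩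
    m · 1# - n · 1#                      ≈⟨ [d+a]-[d+b]≈a-b 1# (m · 1#) (n · 1#) ⟨
    (1# + m · 1#) - (1# + n · 1#)        ≈⟨ +-cong (1+× m 1#) (-‿cong (1+× n 1#)) ⟨
    suc m · 1# - suc n · 1#              ∎

  fromℤ-+ : ∀ i j → fromℤ (i ℤ.+ j) ≈ fromℤ i + fromℤ j
  fromℤ-+ (+ m)    (+ n)    = ×-homo-+ 1# m n
  fromℤ-+ (+ m)    -[1+ n ] = fromℤ-⊖ m (suc n)
  fromℤ-+ -[1+ m ] (+ n)    = trans (fromℤ-⊖ n (suc m)) (+-comm _ _)
  fromℤ-+ -[1+ m ] -[1+ n ] = begin
    - (suc (suc (m ℕ.+ n)) · 1#)         ≡⟨ P.cong (λ k → - (suc k · 1#)) (ℕ.+-suc m n) ⟨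
    - ((suc m ℕ.+ suc n) · 1#)           ≈⟨ -‿cong (×-homo-+ 1# (suc m) (suc n)) ⟩
    - (suc m · 1# + suc n · 1#)          ≈⟨ -‿+-comm _ _ ⟨
    - (suc m · 1#) + - (suc n · 1#)      ∎

  fromℤ-neg : ∀ i → fromℤ (ℤ.- i) ≈ - fromℤ i
  fromℤ-neg (+ zero)  = sym -0#≈0#
  fromℤ-neg (+ suc n) = refl
  fromℤ-neg -[1+ n ]  = sym (-‿involutive _)

  fromℤ-homomorphism : ℤ.+-*-rawRing -Raw-AlmostCommutative⟶ fromCommutativeRing R
  fromℤ-homomorphism = record
    { ⟦_⟧    = fromℤ
    ; +-homo = fromℤ-+
    ; *-homo = fromℤ-*
    ; -‿homo = fromℤ-neg
    ; 0-homo = refl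
    ; 1-homo = refl
    }

  fromℤ-≟ : ∀ i j → Maybe (fromℤ i ≈ fromℤ j)
  fromℤ-≟ i j with i ℤ.≟ j
  ... | yes P.refl = just refl
  ... | no _       = nothing

  open import Algebra.Solver.Ring ℤ.+-*-rawRing (fromCommutativeRing R) fromℤ-homomorphism fromℤ-≟ public

module LinearCombination {c ℓ} (R : CommutativeRing c ℓ) where
  open CommutativeRing R
  open import Algebra.Properties.Ring ring public using ()
    renaming (x≈y⇒x∙y⁻¹≈ε to x≈y⇒x-y≈0; x∙y⁻¹≈ε⇒x≈y to x-y≈0⇒x≈y)

  -- x ≈ y is derived from hypotheses hᵢ ≈ 0# by letting the solver check x = y + Σ kᵢ * hᵢ.
  x≈y+z⇒z≈0⇒x≈y : ∀ {x y z} → x ≈ y + z → z ≈ 0# → x ≈ y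
  x≈y+z⇒z≈0⇒x≈y {y = y} x≈y+z z≈0 = trans x≈y+z (trans (+-congˡ z≈0) (+-identityʳ y))

  *-vanish : ∀ k {x} → x ≈ 0# → k * x ≈ 0#
  *-vanish k x≈0 = trans (*-congˡ x≈0) (zeroʳ k)

  +-vanish : ∀ {x y} → x ≈ 0# → y ≈ 0# → x + y ≈ 0#
  +-vanish x≈0 y≈0 = trans (+-cong x≈0 y≈0) (+-identityʳ 0#)

  +-vanishˡ : ∀ {x y} → x + y ≈ 0# → y ≈ 0# → x ≈ 0#
  +-vanishˡ {x} x+y≈0 y≈0 = trans (sym (trans (+-congˡ y≈0) (+-identityʳ x))) x+y≈0

  +-vanishʳ : ∀ {x y} → x + y ≈ 0# → x ≈ 0# → y ≈ 0#
  +-vanishʳ {x} {y} x+y≈0 x≈0 = trans (sym (trans (+-congʳ x≈0) (+-identityˡ y))) x+y≈0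

  x*y≈1⇒x*[y*z]≈z : ∀ {x y} → x * y ≈ 1# → ∀ z → x * (y * z) ≈ z
  x*y≈1⇒x*[y*z]≈z {x} {y} xy≈1 z = trans (sym (*-assoc x y z)) (trans (*-congʳ xy≈1) (*-identityˡ z))

  x*y≈1⇒y*[x*z]≈z : ∀ {x y} → x * y ≈ 1# → ∀ z → y * (x * z) ≈ z
  x*y≈1⇒y*[x*z]≈z {x} {y} xy≈1 = x*y≈1⇒x*[y*z]≈z (trans (*-comm y x) xy≈1)

module FieldProperties {c ℓ} (F : CommutativeRing c ℓ) (isField : IsFieldCR F) where
  open CommutativeRing F hiding (zero)
  open IntegerCoefficientSolver F
  open LinearCombination F
  open import Algebra.Properties.Semiring.Exp semiring using (_^_)
  open import Algebra.Properties.CommutativeMonoid.Sum *-commutativeMonoid as Π using ()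

  1≉0 : ¬ 1# ≈ 0#
  1≉0 1≈0 = proj₁ isField (sym 1≈0)

  inverse : ∀ x → ¬ x ≈ 0# → ∃[ y ] x * y ≈ 1#
  inverse = proj₂ isField

  x*y≈0⇒y≈0 : ∀ {x y} → ¬ x ≈ 0# → x * y ≈ 0# → y ≈ 0#
  x*y≈0⇒y≈0 {x} {y} x≉0 xy≈0 =
    trans (sym (x*y≈1⇒y*[x*z]≈z (proj₂ (inverse x x≉0)) y)) (*-vanish (proj₁ (inverse x x≉0)) xy≈0)

  x*y≈0⇒x≈0 : ∀ {x y} → ¬ y ≈ 0# → x * y ≈ 0# → x ≈ 0#
  x*y≈0⇒x≈0 {x} {y} y≉0 xy≈0 = x*y≈0⇒y≈0 y≉0 (trans (*-comm y x) xy≈0)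

  *-≉0 : ∀ {x y} → ¬ x ≈ 0# → ¬ y ≈ 0# → ¬ x * y ≈ 0#
  *-≉0 x≉0 y≉0 xy≈0 = y≉0 (x*y≈0⇒y≈0 x≉0 xy≈0)

  x*y≈1⇒y≉0 : ∀ {x y} → x * y ≈ 1# → ¬ y ≈ 0#
  x*y≈1⇒y≉0 {x} xy≈1 y≈0 = 1≉0 (trans (sym xy≈1) (*-vanish x y≈0))

  *-cancelʳ : ∀ {x y z} → ¬ z ≈ 0# → x * z ≈ y * z → x ≈ y
  *-cancelʳ {x} {y} {z} z≉0 xz≈yz = x-y≈0⇒x≈y x y (x*y≈0⇒x≈0 z≉0 (trans
    (solve 3 (λ x y z → (x :- y) :* z := x :* z :- y :* z) refl x y z) (x≈y⇒x-y≈0 xz≈yz)))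

  product-≉0 : ∀ {m} (t : Fin m → Carrier) → (∀ i → ¬ t i ≈ 0#) → ¬ Π.sum t ≈ 0#
  product-≉0 {zero}  t t≉0 = 1≉0
  product-≉0 {suc m} t t≉0 = *-≉0 (t≉0 zero) (product-≉0 (t ∘ suc) (t≉0 ∘ suc))

  ^-≉0 : ∀ m {x} → ¬ x ≈ 0# → ¬ x ^ m ≈ 0#
  ^-≉0 zero    x≉0 = 1≉0
  ^-≉0 (suc m) x≉0 = *-≉0 x≉0 (^-≉0 m x≉0)

module SumProperties {a ℓ} (M : CommutativeMonoid a ℓ) where
  open CommutativeMonoid M renaming (_∙_ to _+_; ε to 0#; ∙-congˡ to +-congˡ)
  open import Algebra.Properties.CommutativeMonoid.Sum M
    using (sum; sum-remove; sum-cong-≋; sum-replicate-zero)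

  sum-single : ∀ {m} (t : Fin m → Carrier) i → (∀ j → j ≢ i → t j ≈ 0#) → sum t ≈ t i
  sum-single {suc m} t i others≈0 = begin
    sum t                                  ≈⟨ sum-remove {i = i} t ⟩
    t i + sum (λ j → t (Fin.punchIn i j))  ≈⟨ +-congˡ (sum-cong-≋ λ j → others≈0 _ (Fin.punchInᵢ≢i i j)) ⟩
    t i + sum {m} (λ _ → 0#)               ≈⟨ +-congˡ (sum-replicate-zero m) ⟩
    t i + 0#                               ≈⟨ identityʳ (t i) ⟩
    t i                                    ∎
    where open import Relation.Binary.Reasoning.Setoid setoid

module MonicPolynomials {c ℓ} (F : CommutativeRing c ℓ) (isField : IsFieldCR F) where
  open CommutativeRing F hiding (zero)
  open IntegerCoefficientSolver F
  open LinearCombination F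
  open FieldProperties F isField
  open import Algebra.Properties.Semiring.Exp semiring using (_^_)
  open import Relation.Binary.Reasoning.Setoid setoid

  -- A monic polynomial of degree d is stored by its d lower coefficients, constant term first.
  Monic : ℕ → Set c
  Monic = Vec Carrier

  eval : ∀ {d} → Monic d → Carrier → Carrier
  eval []      x = 1#
  eval (a ∷ f) x = a + x * eval f x

  addScaled : ∀ {d} → Monic (suc d) → Carrier → Monic d → Monic (suc d)
  addScaled (g₀ ∷ [])     a []       = g₀ + a ∷ []
  addScaled (g₀ ∷ g₁ ∷ g) a (h₀ ∷ h) = g₀ + a * h₀ ∷ addScaled (g₁ ∷ g) a h

  eval-addScaled : ∀ {d} (g : Monic (suc d)) a h x → eval (addScaled g a h) x ≈ eval g x + a * eval h x
  eval-addScaled (g₀ ∷ []) a [] x =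
    solve 3 (λ g₀ a x → (g₀ :+ a) :+ x :* con (+ 1) := (g₀ :+ x :* con (+ 1)) :+ a :* con (+ 1)) refl g₀ a x
  eval-addScaled (g₀ ∷ g₁ ∷ g) a (h₀ ∷ h) x = trans (+-congˡ (*-congˡ (eval-addScaled (g₁ ∷ g) a h x)))
    (solve 6 (λ g₀ h₀ a x G H → (g₀ :+ a :* h₀) :+ x :* (G :+ a :* H) := (g₀ :+ x :* G) :+ a :* (h₀ :+ x :* H))
      refl g₀ h₀ a x (eval (g₁ ∷ g) x) (eval h x))

  quotient : ∀ {d} → Carrier → Monic (suc d) → Monic d
  quotient a (_ ∷ [])     = []
  quotient a (_ ∷ g₁ ∷ g) = addScaled (g₁ ∷ g) a (quotient a (g₁ ∷ g))

  remainder-theorem : ∀ {d} a (f : Monic (suc d)) x → eval f x ≈ eval f a + (x - a) * eval (quotient a f) x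
  remainder-theorem a (f₀ ∷ []) x =
    solve 3 (λ f₀ a x → f₀ :+ x :* con (+ 1) := (f₀ :+ a :* con (+ 1)) :+ (x :- a) :* con (+ 1)) refl f₀ a x
  remainder-theorem a (f₀ ∷ g₁ ∷ g) x = trans
    (x≈y+z⇒z≈0⇒x≈y
      (solve 6 (λ f₀ x a Gx Ga Qx → f₀ :+ x :* Gx :=
                 ((f₀ :+ a :* Ga) :+ (x :- a) :* (Gx :+ a :* Qx)) :+ a :* (Gx :- (Ga :+ (x :- a) :* Qx)))
        refl f₀ x a (eval (g₁ ∷ g) x) (eval (g₁ ∷ g) a) (eval (quotient a (g₁ ∷ g)) x))
      (*-vanish a (x≈y⇒x-y≈0 (remainder-theorem a (g₁ ∷ g) x))))
    (+-congˡ (*-congˡ (sym (eval-addScaled (g₁ ∷ g) a (quotient a (g₁ ∷ g)) x))))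

  roots-bound : ∀ d (f : Monic d) (xs : Fin (suc d) → Carrier) →
                (∀ i j → xs i ≈ xs j → i ≡ j) → ¬ (∀ i → eval f (xs i) ≈ 0#)
  roots-bound zero    []    xs xs-injective roots = 1≉0 (roots zero)
  roots-bound (suc d) f xs xs-injective roots =
    roots-bound d (quotient a f) (xs ∘ suc) (λ i j xsi≈xsj → Fin.suc-injective (xs-injective _ _ xsi≈xsj)) quotient-roots
    where
    a = xs zero
    quotient-roots : ∀ i → eval (quotient a f) (xs (suc i)) ≈ 0#
    quotient-roots i = x*y≈0⇒y≈0 x-a≉0 (begin
      (x - a) * eval (quotient a f) x                    ≈⟨ +-identityˡ _ ⟨
      0# + (x - a) * eval (quotient a f) x               ≈⟨ +-congʳ (roots zero) ⟨
      eval f a + (x - a) * eval (quotient a f) x         ≈⟨ remainder-theorem a f x ⟨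
      eval f x                                           ≈⟨ roots (suc i) ⟩
      0#                                                 ∎)
      where
      x = xs (suc i)
      x-a≉0 : ¬ x - a ≈ 0#
      x-a≉0 x-a≈0 with xs-injective (suc i) zero (x-y≈0⇒x≈y x a x-a≈0)
      ... | ()

  X^[2+k]-X : ∀ k → Monic (2 ℕ.+ k)
  X^[2+k]-X k = 0# ∷ - 1# ∷ replicate k 0#

  eval-X^[2+k]-X : ∀ k x → eval (X^[2+k]-X k) x ≈ x ^ (2 ℕ.+ k) - x
  eval-X^[2+k]-X k x = trans (+-congˡ (*-congˡ (+-congˡ (*-congˡ (eval-zeros k)))))
    (solve 2 (λ x P → con (+ 0) :+ x :* (con -[1+ 0 ] :+ x :* P) := x :* (x :* P) :- x) refl x (x ^ k))
    where
    eval-zeros : ∀ k → eval (replicate k 0#) x ≈ x ^ k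
    eval-zeros zero    = refl
    eval-zeros (suc k) = trans (+-identityˡ _) (*-congˡ (eval-zeros k))

module FiniteField {c ℓ} (F : CommutativeRing c ℓ) (isField : IsFieldCR F) {n : ℕ} (size : HasSize F n) where
  open CommutativeRing F hiding (zero)
  open IntegerCoefficientSolver F
  open LinearCombination F
  open FieldProperties F isField
  open MonicPolynomials F isField
  open import Algebra.Properties.Ring ring using (+-identityʳ-unique)
  open import Algebra.Properties.Semiring.Exp semiring using (_^_; ^-congˡ)
  open import Algebra.Properties.Semiring.Mult semiring using () renaming (_×_ to _·_)
  open import Relation.Binary.Reasoning.Setoid setoid

  enum : Fin n → Carrier
  enum = proj₁ size

  index : Carrier → Fin n
  index x = proj₁ (proj₁ (proj₂ size) x)

  enum-index : ∀ x → enum (index x) ≈ x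
  enum-index x = proj₂ (proj₁ (proj₂ size) x)

  index-unique : ∀ {x i} → x ≈ enum i → index x ≡ i
  index-unique {x} x≈enum-i = proj₂ (proj₂ size) _ _ (trans (enum-index x) x≈enum-i)

  infix 4 _≟_
  _≟_ : Decidable _≈_
  x ≟ y with index x Fin.≟ index y
  ... | yes ix≡iy = yes (begin
    x              ≈⟨ enum-index x ⟨
    enum (index x) ≡⟨ P.cong enum ix≡iy ⟩
    enum (index y) ≈⟨ enum-index y ⟩
    y              ∎)
  ... | no ix≢iy = no λ x≈y → ix≢iy (index-unique (trans x≈y (sym (enum-index y))))

  module _ {a ℓ′} (M : CommutativeMonoid a ℓ′) where
    private module M = CommutativeMonoid M
    open import Algebra.Properties.CommutativeMonoid.Sum M using (sum; sum-permute; sum-cong-≋)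

    sum-bijection : (φ ψ : Carrier → Carrier) →
                    (∀ {x y} → x ≈ y → φ x ≈ φ y) → (∀ {x y} → x ≈ y → ψ x ≈ ψ y) →
                    (∀ x → φ (ψ x) ≈ x) → (∀ x → ψ (φ x) ≈ x) →
                    (h : Carrier → M.Carrier) → (∀ {x y} → x ≈ y → h x M.≈ h y) →
                    sum (h ∘ enum) M.≈ sum (h ∘ φ ∘ enum)
    sum-bijection φ ψ φ-cong ψ-cong φψ ψφ h h-cong =
      M.trans (sum-permute (h ∘ enum) π) (sum-cong-≋ λ i → h-cong (enum-index (φ (enum i))))
      where
      π : Permutation n n
      π = permutation (index ∘ φ ∘ enum) (index ∘ ψ ∘ enum)
            (λ i → index-unique (trans (φ-cong (enum-index _)) (φψ (enum i))))
            (λ i → index-unique (trans (ψ-cong (enum-index _)) (ψφ (enum i))))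

  module Π* = SumProperties *-commutativeMonoid
  open import Algebra.Properties.CommutativeMonoid.Sum +-commutativeMonoid as Σ using ()
  open import Algebra.Properties.CommutativeMonoid.Sum *-commutativeMonoid as Π using ()

  n·1≈0 : n · 1# ≈ 0#
  n·1≈0 = +-identityʳ-unique (Σ.sum enum) (n · 1#) (sym (begin
    Σ.sum enum                           ≈⟨ sum-bijection +-commutativeMonoid (_+ 1#) (_- 1#) +-congʳ +-congʳ
                                              (λ x → solve 1 (λ x → (x :- con (+ 1)) :+ con (+ 1) := x) refl x)
                                              (λ x → solve 1 (λ x → (x :+ con (+ 1)) :- con (+ 1) := x) refl x)
                                              (λ x → x) (λ x≈y → x≈y) ⟩
    Σ.sum (λ i → enum i + 1#)            ≈⟨ Σ.∑-distrib-+ enum (λ _ → 1#) ⟩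
    Σ.sum enum + Σ.sum {n} (λ _ → 1#)    ≈⟨ +-congˡ (Σ.sum-replicate n) ⟩
    Σ.sum enum + n · 1#                  ∎))

  nonzeroPart : Carrier → Carrier
  nonzeroPart y with y ≟ 0#
  ... | yes _ = 1#
  ... | no _  = y

  nonzeroPart≉0 : ∀ y → ¬ nonzeroPart y ≈ 0#
  nonzeroPart≉0 y with y ≟ 0#
  ... | yes _   = 1≉0
  ... | no y≉0  = y≉0

  nonzeroPart-cong : ∀ {x y} → x ≈ y → nonzeroPart x ≈ nonzeroPart y
  nonzeroPart-cong {x} {y} x≈y with x ≟ 0# | y ≟ 0#
  ... | yes _   | yes _   = refl
  ... | yes x≈0 | no y≉0  = ⊥-elim (y≉0 (trans (sym x≈y) x≈0))
  ... | no x≉0  | yes y≈0 = ⊥-elim (x≉0 (trans x≈y y≈0))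
  ... | no _    | no _    = x≈y

  -- Multiplying by x ≉ 0 permutes the field; comparing the products of nonzeroPart over the field
  -- before and after, the only discrepancy is at 0, which correction records.
  module _ {x} (x≉0 : ¬ x ≈ 0#) where
    correction : Carrier → Carrier
    correction y with y ≟ 0#
    ... | yes _ = x
    ... | no _  = 1#

    scale-nonzeroPart : ∀ y → x * nonzeroPart y ≈ nonzeroPart (x * y) * correction y
    scale-nonzeroPart y with y ≟ 0# | x * y ≟ 0#
    ... | yes _   | yes _    = *-comm x 1#
    ... | yes y≈0 | no xy≉0  = ⊥-elim (xy≉0 (*-vanish x y≈0))
    ... | no y≉0  | yes xy≈0 = ⊥-elim (*-≉0 x≉0 y≉0 xy≈0)
    ... | no _    | no _     = sym (*-identityʳ (x * y))

    product-correction : Π.sum (correction ∘ enum) ≈ x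
    product-correction = trans (Π*.sum-single (correction ∘ enum) (index 0#) not-zero⇒1) at-zero
      where
      not-zero⇒1 : ∀ i → i ≢ index 0# → correction (enum i) ≈ 1#
      not-zero⇒1 i i≢i0 with enum i ≟ 0#
      ... | yes enum-i≈0 = ⊥-elim (i≢i0 (P.sym (index-unique (sym enum-i≈0))))
      ... | no _         = refl
      at-zero : correction (enum (index 0#)) ≈ x
      at-zero with enum (index 0#) ≟ 0#
      ... | yes _ = refl
      ... | no enum-i0≉0 = ⊥-elim (enum-i0≉0 (enum-index 0#))

    x^n≈x-nonzero : x ^ n ≈ x
    x^n≈x-nonzero = *-cancelʳ (product-≉0 (nonzeroPart ∘ enum) (nonzeroPart≉0 ∘ enum)) (begin
      x ^ n * P                                                ≈⟨ *-congʳ (Π.sum-replicate n) ⟨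
      Π.sum {n} (λ _ → x) * P                                  ≈⟨ Π.∑-distrib-+ (λ _ → x) (nonzeroPart ∘ enum) ⟨
      Π.sum (λ i → x * nonzeroPart (enum i))                   ≈⟨ Π.sum-cong-≋ (scale-nonzeroPart ∘ enum) ⟩
      Π.sum (λ i → nonzeroPart (x * enum i) * correction (enum i))
                                                               ≈⟨ Π.∑-distrib-+ (nonzeroPart ∘ (x *_) ∘ enum) (correction ∘ enum) ⟩
      Π.sum (nonzeroPart ∘ (x *_) ∘ enum) * Π.sum (correction ∘ enum)
                                                               ≈⟨ *-cong (sym permuted) product-correction ⟩
      P * x                                                    ≈⟨ *-comm P x ⟩
      x * P                                                    ∎)
      where
      P = Π.sum (nonzeroPart ∘ enum)
      x⁻¹ = proj₁ (inverse x x≉0)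
      x*x⁻¹≈1 = proj₂ (inverse x x≉0)
      permuted : P ≈ Π.sum (nonzeroPart ∘ (x *_) ∘ enum)
      permuted = sum-bijection *-commutativeMonoid (x *_) (x⁻¹ *_) *-congˡ *-congˡ
        (x*y≈1⇒x*[y*z]≈z x*x⁻¹≈1) (x*y≈1⇒y*[x*z]≈z x*x⁻¹≈1) nonzeroPart nonzeroPart-cong

  x^n≈x : ∀ x → x ^ n ≈ x
  x^n≈x x with x ≟ 0#
  ... | no x≉0  = x^n≈x-nonzero x≉0
  ... | yes x≈0 = trans (^-congˡ n x≈0) (trans (0^m≈0 (index 0#)) (sym x≈0))
    where
    0^m≈0 : ∀ {m} → Fin m → 0# ^ m ≈ 0#
    0^m≈0 {suc m} _ = zeroˡ (0# ^ m)

  ∃-non-root : ∀ {d} (f : Monic d) → d ℕ.< n → ∃[ x ] ¬ eval f x ≈ 0#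
  ∃-non-root {d} f d<n with Fin.all? (λ i → eval f (enum i) ≟ 0#)
  ... | yes all-roots = ⊥-elim (roots-bound d f (enum ∘ inject) inject-injective (all-roots ∘ inject))
    where
    inject : Fin (suc d) → Fin n
    inject i = Fin.inject≤ i d<n
    inject-injective : ∀ i j → enum (inject i) ≈ enum (inject j) → i ≡ j
    inject-injective i j e = Fin.inject≤-injective d<n d<n i j (proj₂ (proj₂ size) _ _ e)
  ... | no not-all = let (i , non-root) = Fin.¬∀⟶∃¬ n _ (λ i → eval f (enum i) ≟ 0#) not-all in enum i , non-root

  ∃-x^m≉x : ∀ m → 2 ℕ.≤ m → m ℕ.< n → ∃[ x ] ¬ x ^ m ≈ x
  ∃-x^m≉x (suc zero) (ℕ.s≤s ()) _
  ∃-x^m≉x (suc (suc k)) _ m<n =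
    let (x , non-root) = ∃-non-root (X^[2+k]-X k) m<n
    in x , λ x^m≈x → non-root (trans (eval-X^[2+k]-X k x) (x≈y⇒x-y≈0 x^m≈x))

  characteristic : ∀ p m → n ≡ p ℕ.^ m → p · 1# ≈ 0#
  characteristic p m n≡p^m with p · 1# ≟ 0#
  ... | yes p·1≈0 = p·1≈0
  ... | no p·1≉0  = ⊥-elim (^-≉0 m p·1≉0 (begin
    (p · 1#) ^ m      ≈⟨ ^-·1 m ⟨
    (p ℕ.^ m) · 1#    ≡⟨ P.cong (_· 1#) n≡p^m ⟨
    n · 1#            ≈⟨ n·1≈0 ⟩
    0#                ∎))
    where
    open import Algebra.Properties.Semiring.Mult semiring using (×1-homo-*)
    ^-·1 : ∀ m → (p ℕ.^ m) · 1# ≈ (p · 1#) ^ m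
    ^-·1 zero    = +-identityʳ 1#
    ^-·1 (suc m) = trans (×1-homo-* p (p ℕ.^ m)) (*-congˡ (^-·1 m))

module BinomialCoefficients where
  open import Data.Nat
  open import Data.Nat.Properties
  open import Data.Nat.Combinatorics using (_C_; nC1≡n; nCk+nC[k+1]≡[n+1]C[k+1])
  open import Data.Nat.Divisibility using (_∣_; divides; ∣⇒≤)
  open import Data.Nat.Primality using (Prime; euclidsLemma)
  open import Data.Nat.Solver using (module +-*-Solver)
  open import Data.Sum using (inj₁; inj₂)
  open import Relation.Nullary using (contradiction)
  open import Relation.Binary.PropositionalEquality

  [k+1]*[n+1]C[k+1]≡[n+1]*nCk : ∀ n k → suc k * (suc n C suc k) ≡ suc n * (n C k)
  [k+1]*[n+1]C[k+1]≡[n+1]*nCk zero    zero    = refl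
  [k+1]*[n+1]C[k+1]≡[n+1]*nCk zero    (suc k) = *-zeroʳ (2 + k)
  [k+1]*[n+1]C[k+1]≡[n+1]*nCk (suc n) zero    = trans (+-identityʳ _) (trans (nC1≡n (2 + n)) (sym (*-identityʳ (2 + n))))
  [k+1]*[n+1]C[k+1]≡[n+1]*nCk (suc n) (suc k) = begin
    (2 + k) * (suc (suc n) C suc (suc k))
      ≡⟨ cong ((2 + k) *_) (nCk+nC[k+1]≡[n+1]C[k+1] (suc n) (suc k)) ⟨
    (2 + k) * (a + b)
      ≡⟨ solve 3 (λ k a b → (con 2 :+ k) :* (a :+ b) := a :+ (con 1 :+ k) :* a :+ (con 2 :+ k) :* b) refl k a b ⟩
    a + (1 + k) * a + (2 + k) * b
      ≡⟨ cong₂ (λ u v → a + u + v) ([k+1]*[n+1]C[k+1]≡[n+1]*nCk n k) ([k+1]*[n+1]C[k+1]≡[n+1]*nCk n (suc k)) ⟩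
    a + (1 + n) * (n C k) + (1 + n) * (n C suc k)
      ≡⟨ solve 4 (λ n a c d → a :+ (con 1 :+ n) :* c :+ (con 1 :+ n) :* d := a :+ (con 1 :+ n) :* (c :+ d))
           refl n a (n C k) (n C suc k) ⟩
    a + (1 + n) * (n C k + n C suc k)
      ≡⟨ cong (λ c → a + (1 + n) * c) (nCk+nC[k+1]≡[n+1]C[k+1] n k) ⟩
    (2 + n) * a
      ∎
    where
    open ≡-Reasoning
    open +-*-Solver
    a = suc n C suc k
    b = suc n C suc (suc k)

  p∣pC[k+1] : ∀ {p} → Prime p → ∀ k → suc k < p → p ∣ p C suc k
  p∣pC[k+1] {suc p} p-prime k k+1<p with euclidsLemma (suc k) (suc p C suc k) p-prime
    (divides (p C k) (trans ([k+1]*[n+1]C[k+1]≡[n+1]*nCk p k) (*-comm (suc p) (p C k))))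
  ... | inj₁ p∣k+1 = contradiction (∣⇒≤ p∣k+1) (<⇒≱ k+1<p)
  ... | inj₂ p∣C   = p∣C

module PrimeCharacteristic {c ℓ} (R : CommutativeRing c ℓ) where
  open BinomialCoefficients using (p∣pC[k+1])
  open CommutativeRing R hiding (zero)
  open import Algebra.Properties.Semiring.Exp semiring using (_^_; ^-congˡ; ^-assocʳ)
  open import Algebra.Properties.Semiring.Mult semiring using (×-assoc-*; ×-congʳ; ×1-homo-*) renaming (_×_ to _·_)
  import Algebra.Properties.CommutativeSemiring.Binomial commutativeSemiring as Binomial
  open import Algebra.Properties.CommutativeMonoid.Sum +-commutativeMonoid as Σ using ()
  module Σ+ = SumProperties +-commutativeMonoid
  open import Relation.Binary.Reasoning.Setoid setoid

  multiple-of-char-vanishes : ∀ {p m} → p · 1# ≈ 0# → p ∣ m → ∀ w → m · w ≈ 0#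
  multiple-of-char-vanishes {p} p·1≈0 (divides t P.refl) w = begin
    (t ℕ.* p) · w                   ≈⟨ ×-congʳ (t ℕ.* p) (*-identityˡ w) ⟨
    (t ℕ.* p) · (1# * w)            ≈⟨ ×-assoc-* (t ℕ.* p) 1# w ⟨
    ((t ℕ.* p) · 1#) * w            ≈⟨ *-congʳ (×1-homo-* t p) ⟩
    ((t · 1#) * (p · 1#)) * w       ≈⟨ *-congʳ (*-congˡ p·1≈0) ⟩
    ((t · 1#) * 0#) * w             ≈⟨ *-congʳ (zeroʳ (t · 1#)) ⟩
    0# * w                          ≈⟨ zeroˡ w ⟩
    0#                              ∎

  freshman : ∀ {p} → Prime p → p · 1# ≈ 0# → ∀ x y → (x + y) ^ p ≈ x ^ p + y ^ p
  freshman {suc p} p-prime p·1≈0 x y = begin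
    (x + y) ^ suc p              ≈⟨ Binomial.theorem (suc p) x y ⟩
    T zero + Σ.sum (T ∘ suc)     ≈⟨ +-cong first (trans (Σ+.sum-single (T ∘ suc) (fromℕ p) middle) last) ⟩
    y ^ suc p + x ^ suc p        ≈⟨ +-comm _ _ ⟩
    x ^ suc p + y ^ suc p        ∎
    where
    T = Binomial.binomialTerm x y (suc p)
    first : T zero ≈ y ^ suc p
    first = trans (+-identityʳ _) (*-identityˡ _)
    last : T (suc (fromℕ p)) ≈ x ^ suc p
    last rewrite Fin.toℕ-fromℕ p | nCn≡1 (suc p) | ℕ.n∸n≡0 p = trans (+-identityʳ _) (*-identityʳ _)
    middle : ∀ i → i ≢ fromℕ p → T (suc i) ≈ 0#
    middle i i≢p = multiple-of-char-vanishes p·1≈0 (p∣pC[k+1] p-prime (toℕ i) (ℕ.s≤s toℕi<p)) _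
      where
      toℕi<p : toℕ i ℕ.< p
      toℕi<p = ℕ.≤∧≢⇒< (Fin.toℕ≤pred[n] i) (λ toℕi≡p → i≢p (Fin.toℕ-injective (P.trans toℕi≡p (P.sym (Fin.toℕ-fromℕ p)))))

  freshman-^ : ∀ {p} → Prime p → p · 1# ≈ 0# → ∀ e x y → (x + y) ^ (p ℕ.^ e) ≈ x ^ (p ℕ.^ e) + y ^ (p ℕ.^ e)
  freshman-^ p-prime p·1≈0 zero    x y = trans (*-identityʳ _) (sym (+-cong (*-identityʳ x) (*-identityʳ y)))
  freshman-^ {p} p-prime p·1≈0 (suc e) x y = begin
    (x + y) ^ (p ℕ.* p ℕ.^ e)                   ≈⟨ ^-assocʳ (x + y) p (p ℕ.^ e) ⟨
    ((x + y) ^ p) ^ (p ℕ.^ e)                   ≈⟨ ^-congˡ (p ℕ.^ e) (freshman p-prime p·1≈0 x y) ⟩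
    (x ^ p + y ^ p) ^ (p ℕ.^ e)                 ≈⟨ freshman-^ p-prime p·1≈0 e (x ^ p) (y ^ p) ⟩
    (x ^ p) ^ (p ℕ.^ e) + (y ^ p) ^ (p ℕ.^ e)   ≈⟨ +-cong (^-assocʳ x p (p ℕ.^ e)) (^-assocʳ y p (p ℕ.^ e)) ⟩
    x ^ (p ℕ.* p ℕ.^ e) + y ^ (p ℕ.* p ℕ.^ e)   ∎

record IsNontrivialInvolution {c ℓ} (F : CommutativeRing c ℓ) (σ : CommutativeRing.Carrier F → CommutativeRing.Carrier F) : Set (c ⊔ ℓ) where
  open CommutativeRing F
  field
    cong       : ∀ {x y} → x ≈ y → σ x ≈ σ y
    +-homo     : ∀ x y → σ (x + y) ≈ σ x + σ y
    *-homo     : ∀ x y → σ (x * y) ≈ σ x * σ y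
    involutive : ∀ x → σ (σ x) ≈ x
    nonfixed   : ∃[ ε ] ¬ σ ε ≈ ε

module FrobeniusInvolution {c ℓ} (F : CommutativeRing c ℓ) (isField : IsFieldCR F) where
  open CommutativeRing F hiding (zero)
  open import Algebra.Properties.Semiring.Exp semiring using (_^_; ^-congˡ; ^-assocʳ)
  open import Algebra.Properties.CommutativeSemiring.Exp commutativeSemiring using (^-distrib-*)

  frob≈^ : ∀ q x → Geometry.frob F q x ≈ x ^ q
  frob≈^ q x = pow≈^ q
    where
    pow≈^ : ∀ m → Geometry.pow F q x m ≈ x ^ m
    pow≈^ zero    = refl
    pow≈^ (suc m) = *-congˡ (pow≈^ m)

  frobenius-involution : ∀ {p k q} → Prime p → q ≡ p ℕ.^ suc k → HasSize F (q ℕ.* q) →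
                         IsNontrivialInvolution F (Geometry.frob F q)
  frobenius-involution {p} {k} {q} p-prime q≡p^k+1 size = record
    { cong       = λ {x} {y} x≈y → trans (frob≈^ q x) (trans (^-congˡ q x≈y) (sym (frob≈^ q y)))
    ; +-homo     = λ x y → trans (frob≈^ q (x + y)) (trans (+-homo-^ x y) (sym (+-cong (frob≈^ q x) (frob≈^ q y))))
    ; *-homo     = λ x y → trans (frob≈^ q (x * y)) (trans (^-distrib-* x y q) (sym (*-cong (frob≈^ q x) (frob≈^ q y))))
    ; involutive = λ x → trans (frob≈^ q (Geometry.frob F q x)) (trans (^-congˡ q (frob≈^ q x))
                           (trans (^-assocʳ x q q) (FiniteField.x^n≈x F isField size x)))
    ; nonfixed   = let (ε , ε^q≉ε) = FiniteField.∃-x^m≉x F isField size q 1<q q<q*q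
                   in ε , λ frob-ε≈ε → ε^q≉ε (trans (sym (frob≈^ q ε)) frob-ε≈ε)
    }
    where
    1<p : 1 ℕ.< p
    1<p = ℕ.nonTrivial⇒n>1 p {{prime⇒nonTrivial p-prime}}
    1<q : 1 ℕ.< q
    1<q = P.subst (1 ℕ.<_) (P.sym q≡p^k+1) (ℕ.<-≤-trans 1<p
            (ℕ.≤-trans (ℕ.m≤m*n p 1) (ℕ.^-monoʳ-≤ p {{ℕ.>-nonZero (ℕ.<-trans ℕ.z<s 1<p)}} (ℕ.s≤s (ℕ.z≤n {k})))))
    q<q*q : q ℕ.< q ℕ.* q
    q<q*q = ℕ.m<m*n q q {{ℕ.>-nonZero (ℕ.<-trans ℕ.z<s 1<q)}} 1<q
    q*q≡p^[2k+2] : q ℕ.* q ≡ p ℕ.^ (suc k ℕ.+ suc k)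
    q*q≡p^[2k+2] = P.trans (P.cong₂ ℕ._*_ q≡p^k+1 q≡p^k+1) (P.sym (ℕ.^-distribˡ-+-* p (suc k) (suc k)))
    +-homo-^ : ∀ x y → (x + y) ^ q ≈ x ^ q + y ^ q
    +-homo-^ x y = P.subst (λ m → (x + y) ^ m ≈ x ^ m + y ^ m) (P.sym q≡p^k+1)
      (PrimeCharacteristic.freshman-^ F p-prime (FiniteField.characteristic F isField size p (suc k ℕ.+ suc k) q*q≡p^[2k+2]) (suc k) x y)

module Conjugation {c ℓ} (F : CommutativeRing c ℓ) (isField : IsFieldCR F)
                   (_≟_ : Decidable (CommutativeRing._≈_ F))
                   {frob : CommutativeRing.Carrier F → CommutativeRing.Carrier F}
                   (frob-involution : IsNontrivialInvolution F frob) where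
  open CommutativeRing F hiding (zero)
  open IntegerCoefficientSolver F
  open LinearCombination F
  open FieldProperties F isField
  open IsNontrivialInvolution frob-involution public
    renaming (cong to frob-cong; +-homo to frob-+; *-homo to frob-*; involutive to frob-involutive)
  open import Algebra.Properties.Ring ring using (x+x≈x⇒x≈0; +-inverseʳ-unique)
  open import Relation.Binary.Reasoning.Setoid setoid

  Fixed : Carrier → Set ℓ
  Fixed x = frob x ≈ x

  norm : Carrier → Carrier
  norm x = x * frob x

  frob-0 : frob 0# ≈ 0#
  frob-0 = x+x≈x⇒x≈0 (frob 0#) (trans (sym (frob-+ 0# 0#)) (frob-cong (+-identityʳ 0#)))

  frob-1 : frob 1# ≈ 1#
  frob-1 = begin
    frob 1#                    ≈⟨ *-identityʳ (frob 1#) ⟨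
    frob 1# * 1#               ≈⟨ *-congˡ (frob-involutive 1#) ⟨
    frob 1# * frob (frob 1#)   ≈⟨ frob-* 1# (frob 1#) ⟨
    frob (1# * frob 1#)        ≈⟨ frob-cong (*-identityˡ (frob 1#)) ⟩
    frob (frob 1#)             ≈⟨ frob-involutive 1# ⟩
    1#                         ∎

  frob-neg : ∀ x → frob (- x) ≈ - frob x
  frob-neg x = +-inverseʳ-unique (frob x) (frob (- x))
    (trans (sym (frob-+ x (- x))) (trans (frob-cong (-‿inverseʳ x)) frob-0))

  frob-sub : ∀ x y → frob (x - y) ≈ frob x - frob y
  frob-sub x y = trans (frob-+ x (- y)) (+-congˡ (frob-neg y))

  frob≈0⇒≈0 : ∀ {x} → frob x ≈ 0# → x ≈ 0#
  frob≈0⇒≈0 {x} frob-x≈0 = trans (sym (frob-involutive x)) (trans (frob-cong frob-x≈0) frob-0)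

  frob-≉0 : ∀ {x} → ¬ x ≈ 0# → ¬ frob x ≈ 0#
  frob-≉0 x≉0 = x≉0 ∘ frob≈0⇒≈0

  frob-*+* : ∀ p x r y → frob (p * x + r * y) ≈ frob p * frob x + frob r * frob y
  frob-*+* p x r y = trans (frob-+ _ _) (+-cong (frob-* p x) (frob-* r y))

  frob-fixed-*+* : ∀ {p r} → Fixed p → Fixed r → ∀ x y → frob (p * x + r * y) ≈ p * frob x + r * frob y
  frob-fixed-*+* p-fixed r-fixed x y = trans (frob-*+* _ x _ y) (+-cong (*-congʳ p-fixed) (*-congʳ r-fixed))

  fixed-neg : ∀ {s} → Fixed s → Fixed (- s)
  fixed-neg {s} s-fixed = trans (frob-neg s) (-‿cong s-fixed)

  frob-norm : ∀ x → frob (norm x) ≈ norm x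
  frob-norm x = trans (frob-* x (frob x)) (trans (*-congˡ (frob-involutive x)) (*-comm _ _))

  ε : Carrier
  ε = proj₁ nonfixed

  ε≉0 : ¬ ε ≈ 0#
  ε≉0 ε≈0 = proj₂ nonfixed (trans (frob-cong ε≈0) (trans frob-0 (sym ε≈0)))

  δ : Carrier
  δ = ε - frob ε

  δ≉0 : ¬ δ ≈ 0#
  δ≉0 δ≈0 = proj₂ nonfixed (sym (x-y≈0⇒x≈y ε (frob ε) δ≈0))

  frob-δ : frob δ ≈ - δ
  frob-δ = trans (frob-sub ε (frob ε)) (trans (+-congˡ (-‿cong (frob-involutive ε)))
    (solve 2 (λ e e′ → e′ :- e := :- (e :- e′)) refl ε (frob ε)))

  trace-coordinates : ∀ {A B} → A + frob A ≈ B + frob B →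
    ∃[ α ] ∃[ β ] ∃[ γ ] ((α + ε * β + ε * γ ≈ A) × (α + ε * β + frob ε * γ ≈ B) ×
                          (α + frob ε * β + ε * γ ≈ frob B) × (α + frob ε * β + frob ε * γ ≈ frob A))
  trace-coordinates {A} {B} traces≈ = α , β , γ , L₁ , L₂ , L₃ , L₄
    where
    δ⁻¹ = proj₁ (inverse δ δ≉0)
    γ = δ⁻¹ * (A - B)
    β = δ⁻¹ * (A - frob B)
    α = A - ε * β - ε * γ
    δγ≈A-B : δ * γ ≈ A - B
    δγ≈A-B = x*y≈1⇒x*[y*z]≈z (proj₂ (inverse δ δ≉0)) (A - B)
    δβ≈A-B̄ : δ * β ≈ A - frob B
    δβ≈A-B̄ = x*y≈1⇒x*[y*z]≈z (proj₂ (inverse δ δ≉0)) (A - frob B)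
    L₁ : α + ε * β + ε * γ ≈ A
    L₁ = solve 4 (λ A e b g → A :- e :* b :- e :* g :+ e :* b :+ e :* g := A) refl A ε β γ
    L₂ : α + ε * β + frob ε * γ ≈ B
    L₂ = begin
      α + ε * β + frob ε * γ    ≈⟨ solve 5 (λ A e e′ b g → A :- e :* b :- e :* g :+ e :* b :+ e′ :* g
                                                     := A :- (e :- e′) :* g) refl A ε (frob ε) β γ ⟩
      A - δ * γ                 ≈⟨ +-congˡ (-‿cong δγ≈A-B) ⟩
      A - (A - B)               ≈⟨ solve 2 (λ A B → A :- (A :- B) := B) refl A B ⟩
      B                         ∎
    L₃ : α + frob ε * β + ε * γ ≈ frob B
    L₃ = begin
      α + frob ε * β + ε * γ    ≈⟨ solve 5 (λ A e e′ b g → A :- e :* b :- e :* g :+ e′ :* b :+ e :* g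
                                                     := A :- (e :- e′) :* b) refl A ε (frob ε) β γ ⟩
      A - δ * β                 ≈⟨ +-congˡ (-‿cong δβ≈A-B̄) ⟩
      A - (A - frob B)          ≈⟨ solve 2 (λ A B′ → A :- (A :- B′) := B′) refl A (frob B) ⟩
      frob B                    ∎
    L₄ : α + frob ε * β + frob ε * γ ≈ frob A
    L₄ = begin
      α + frob ε * β + frob ε * γ          ≈⟨ solve 5 (λ A e e′ b g → A :- e :* b :- e :* g :+ e′ :* b :+ e′ :* g
                                                                   := A :- (e :- e′) :* b :- (e :- e′) :* g) refl A ε (frob ε) β γ ⟩
      A - δ * β - δ * γ                    ≈⟨ +-cong (+-congˡ (-‿cong δβ≈A-B̄)) (-‿cong δγ≈A-B) ⟩
      A - (A - frob B) - (A - B)           ≈⟨ solve 3 (λ A B B′ → A :- (A :- B′) :- (A :- B) := (B :+ B′) :- A) refl A B (frob B) ⟩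
      (B + frob B) - A                     ≈⟨ +-congʳ traces≈ ⟨
      (A + frob A) - A                     ≈⟨ solve 2 (λ A A′ → (A :+ A′) :- A := A′) refl A (frob A) ⟩
      frob A                               ∎

  trace-coordinates-injective : ∀ {α β γ} → α + ε * β + ε * γ ≈ 0# → α + ε * β + frob ε * γ ≈ 0# →
                                α + frob ε * β + ε * γ ≈ 0# → α ≈ 0# × β ≈ 0# × γ ≈ 0#
  trace-coordinates-injective {α} {β} {γ} L₁ L₂ L₃ = α≈0 , β≈0 , γ≈0
    where
    γ≈0 : γ ≈ 0#
    γ≈0 = x*y≈0⇒y≈0 δ≉0 (x≈y+z⇒z≈0⇒x≈y
      (solve 5 (λ a b g e e′ → (e :- e′) :* g := con (+ 0) :+ ((a :+ e :* b :+ e :* g) :- (a :+ e :* b :+ e′ :* g))) refl α β γ ε (frob ε))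
      (trans (+-cong L₁ (-‿cong L₂)) (-‿inverseʳ 0#)))
    β≈0 : β ≈ 0#
    β≈0 = x*y≈0⇒y≈0 δ≉0 (x≈y+z⇒z≈0⇒x≈y
      (solve 5 (λ a b g e e′ → (e :- e′) :* b := con (+ 0) :+ ((a :+ e :* b :+ e :* g) :- (a :+ e′ :* b :+ e :* g))) refl α β γ ε (frob ε))
      (trans (+-cong L₁ (-‿cong L₃)) (-‿inverseʳ 0#)))
    α≈0 : α ≈ 0#
    α≈0 = x≈y+z⇒z≈0⇒x≈y
      (solve 4 (λ a b g e → a := con (+ 0) :+ ((a :+ e :* b :+ e :* g) :+ ((:- e) :* b :+ (:- e) :* g))) refl α β γ ε)
      (+-vanish L₁ (+-vanish (*-vanish _ β≈0) (*-vanish _ γ≈0)))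

  ∃-trace-zero-multiple : ∀ g → ∃[ θ ] (¬ θ ≈ 0# × θ * g + frob (θ * g) ≈ 0#)
  ∃-trace-zero-multiple g with g ≟ 0#
  ... | yes g≈0 = 1# , 1≉0 , +-vanish 1g≈0 (trans (frob-cong 1g≈0) frob-0)
    where 1g≈0 = trans (*-identityˡ g) g≈0
  ... | no g≉0  = frob g * δ , *-≉0 (frob-≉0 g≉0) δ≉0 , (begin
    frob g * δ * g + frob (frob g * δ * g)               ≈⟨ +-congˡ (trans (frob-* _ g) (*-congʳ (frob-* (frob g) δ))) ⟩
    frob g * δ * g + frob (frob g) * frob δ * frob g     ≈⟨ +-congˡ (*-congʳ (*-cong (frob-involutive g) frob-δ)) ⟩
    frob g * δ * g + g * - δ * frob g                    ≈⟨ solve 3 (λ g g′ d → g′ :* d :* g :+ g :* (:- d) :* g′ := con (+ 0)) refl g (frob g) δ ⟩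
    0#                                                   ∎)

module VectorAlgebra {c ℓ} (F : CommutativeRing c ℓ) (q : ℕ) where
  open CommutativeRing F hiding (zero)
  open Geometry F q
  open IntegerCoefficientSolver F
  open LinearCombination F
  open import Relation.Binary.Reasoning.Setoid setoid

  ≈₄-refl : ∀ {v} → v ≈₄ v
  ≈₄-refl = refl , refl , refl , refl

  ≈₄-sym : ∀ {v w} → v ≈₄ w → w ≈₄ v
  ≈₄-sym (e₀ , e₁ , e₂ , e₃) = sym e₀ , sym e₁ , sym e₂ , sym e₃

  ≈₄-trans : ∀ {u v w} → u ≈₄ v → v ≈₄ w → u ≈₄ w
  ≈₄-trans (e₀ , e₁ , e₂ , e₃) (f₀ , f₁ , f₂ , f₃) = trans e₀ f₀ , trans e₁ f₁ , trans e₂ f₂ , trans e₃ f₃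

  Qf-cong : ∀ {v w} → v ≈₄ w → Qf v ≈ Qf w
  Qf-cong (e₀ , e₁ , e₂ , e₃) = +-cong (*-cong e₀ e₃) (-‿cong (*-cong e₁ e₂))

  Bf-congˡ : ∀ {v w} r → v ≈₄ w → Bf v r ≈ Bf w r
  Bf-congˡ r (e₀ , e₁ , e₂ , e₃) =
    +-cong (+-cong (+-cong (*-congʳ e₀) (*-congʳ e₃)) (-‿cong (*-congʳ e₁))) (-‿cong (*-congʳ e₂))

  Bf-congʳ : ∀ r {v w} → v ≈₄ w → Bf r v ≈ Bf r w
  Bf-congʳ r (e₀ , e₁ , e₂ , e₃) =
    +-cong (+-cong (+-cong (*-congˡ e₃) (*-congˡ e₀)) (-‿cong (*-congˡ e₂))) (-‿cong (*-congˡ e₁))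

  Bf-scaleˡ : ∀ ρ x y → Bf (ρ • x) y ≈ ρ * Bf x y
  Bf-scaleˡ ρ (x₀ , x₁ , x₂ , x₃) (y₀ , y₁ , y₂ , y₃) =
    solve 9 (λ ρ x₀ x₁ x₂ x₃ y₀ y₁ y₂ y₃ →
      (((ρ :* x₀) :* y₃ :+ (ρ :* x₃) :* y₀) :- (ρ :* x₁) :* y₂) :- (ρ :* x₂) :* y₁
      := ρ :* (((x₀ :* y₃ :+ x₃ :* y₀) :- x₁ :* y₂) :- x₂ :* y₁))
      refl ρ x₀ x₁ x₂ x₃ y₀ y₁ y₂ y₃

  Bf-linear₂ : ∀ r l m u v → Bf r ((l • u) ⊕ (m • v)) ≈ l * Bf r u + m * Bf r v
  Bf-linear₂ (r₀ , r₁ , r₂ , r₃) l m (u₀ , u₁ , u₂ , u₃) (v₀ , v₁ , v₂ , v₃) =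
    solve 14 (λ l m r₀ r₁ r₂ r₃ u₀ u₁ u₂ u₃ v₀ v₁ v₂ v₃ →
      ((r₀ :* (l :* u₃ :+ m :* v₃) :+ r₃ :* (l :* u₀ :+ m :* v₀)) :- r₁ :* (l :* u₂ :+ m :* v₂)) :- r₂ :* (l :* u₁ :+ m :* v₁)
      := l :* (((r₀ :* u₃ :+ r₃ :* u₀) :- r₁ :* u₂) :- r₂ :* u₁) :+ m :* (((r₀ :* v₃ :+ r₃ :* v₀) :- r₁ :* v₂) :- r₂ :* v₁))
      refl l m r₀ r₁ r₂ r₃ u₀ u₁ u₂ u₃ v₀ v₁ v₂ v₃

  Bf-linear₃ : ∀ r α β γ x y w → Bf r (((α • x) ⊕ (β • y)) ⊕ (γ • w)) ≈ α * Bf r x + β * Bf r y + γ * Bf r w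
  Bf-linear₃ r α β γ x y w = begin
    Bf r (((α • x) ⊕ (β • y)) ⊕ (γ • w))                ≈⟨ Bf-congʳ r (1•-sum , 1•-sum , 1•-sum , 1•-sum) ⟨
    Bf r ((1# • ((α • x) ⊕ (β • y))) ⊕ (γ • w))         ≈⟨ Bf-linear₂ r 1# γ _ w ⟩
    1# * Bf r ((α • x) ⊕ (β • y)) + γ * Bf r w          ≈⟨ +-congʳ (trans (*-identityˡ _) (Bf-linear₂ r α β x y)) ⟩
    α * Bf r x + β * Bf r y + γ * Bf r w                ∎
    where
    1•-sum : ∀ {a b} → 1# * a + b ≈ a + b
    1•-sum = +-congʳ (*-identityˡ _)

  •⊕-subst : ∀ {x y u v λ′ μ′} l m → x ≈₄ (λ′ • u) → y ≈₄ (μ′ • v) →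
             ((l • x) ⊕ (m • y)) ≈₄ (((l * λ′) • u) ⊕ ((m * μ′) • v))
  •⊕-subst {λ′ = λ′} {μ′} l m (e₀ , e₁ , e₂ , e₃) (f₀ , f₁ , f₂ , f₃) =
    component e₀ f₀ , component e₁ f₁ , component e₂ f₂ , component e₃ f₃
    where
    component : ∀ {xᵢ yᵢ uᵢ vᵢ} → xᵢ ≈ λ′ * uᵢ → yᵢ ≈ μ′ * vᵢ → l * xᵢ + m * yᵢ ≈ (l * λ′) * uᵢ + (m * μ′) * vᵢ
    component eᵢ fᵢ = trans (+-cong (*-congˡ eᵢ) (*-congˡ fᵢ)) (sym (+-cong (*-assoc l λ′ _) (*-assoc m μ′ _)))

  •-invert : ∀ {u x λ′ λ⁻¹} → λ′ * λ⁻¹ ≈ 1# → u ≈₄ (λ′ • x) → x ≈₄ (λ⁻¹ • u)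
  •-invert {λ′ = λ′} {λ⁻¹} λλ⁻¹≈1 (e₀ , e₁ , e₂ , e₃) = component e₀ , component e₁ , component e₂ , component e₃
    where
    component : ∀ {uᵢ xᵢ} → uᵢ ≈ λ′ * xᵢ → xᵢ ≈ λ⁻¹ * uᵢ
    component {uᵢ} {xᵢ} eᵢ = trans (sym (x*y≈1⇒y*[x*z]≈z λλ⁻¹≈1 xᵢ)) (*-congˡ (sym eᵢ))

  •-zeroˡ : ∀ {k} v → k ≈ 0# → (k • v) ≈₄ 𝟎
  •-zeroˡ (v₀ , v₁ , v₂ , v₃) k≈0 = component , component , component , component
    where
    component : ∀ {vᵢ} → _ * vᵢ ≈ 0#
    component = trans (*-congʳ k≈0) (zeroˡ _)

  •-zeroʳ : ∀ k {v} → v ≈₄ 𝟎 → (k • v) ≈₄ 𝟎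
  •-zeroʳ k (e₀ , e₁ , e₂ , e₃) = *-vanish k e₀ , *-vanish k e₁ , *-vanish k e₂ , *-vanish k e₃

  •-congʳ : ∀ k {v w} → v ≈₄ w → (k • v) ≈₄ (k • w)
  •-congʳ k (e₀ , e₁ , e₂ , e₃) = *-congˡ e₀ , *-congˡ e₁ , *-congˡ e₂ , *-congˡ e₃

  Bf-sym : ∀ x y → Bf x y ≈ Bf y x
  Bf-sym (x₀ , x₁ , x₂ , x₃) (y₀ , y₁ , y₂ , y₃) =
    solve 8 (λ x₀ x₁ x₂ x₃ y₀ y₁ y₂ y₃ → ((x₀ :* y₃ :+ x₃ :* y₀) :- x₁ :* y₂) :- x₂ :* y₁
                                        := ((y₀ :* x₃ :+ y₃ :* x₀) :- y₁ :* x₂) :- y₂ :* x₁)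
      refl x₀ x₁ x₂ x₃ y₀ y₁ y₂ y₃

  •⊕-zero : ∀ {l m} x y → l ≈ 0# → m ≈ 0# → ((l • x) ⊕ (m • y)) ≈₄ 𝟎
  •⊕-zero {l} {m} _ _ l≈0 m≈0 = vanish , vanish , vanish , vanish
    where
    vanish : ∀ {x y} → l * x + m * y ≈ 0#
    vanish = +-vanish (trans (*-congʳ l≈0) (zeroˡ _)) (trans (*-congʳ m≈0) (zeroˡ _))

  •⊕-cong : ∀ l m {x y x′ y′} → x ≈₄ x′ → y ≈₄ y′ → ((l • x) ⊕ (m • y)) ≈₄ ((l • x′) ⊕ (m • y′))
  •⊕-cong l m (e₀ , e₁ , e₂ , e₃) (f₀ , f₁ , f₂ , f₃) =
    +-cong (*-congˡ e₀) (*-congˡ f₀) , +-cong (*-congˡ e₁) (*-congˡ f₁) ,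
    +-cong (*-congˡ e₂) (*-congˡ f₂) , +-cong (*-congˡ e₃) (*-congˡ f₃)

  •⊕-collect : ∀ l m a b a′ b′ x y →
    ((l • ((a • x) ⊕ (b • y))) ⊕ (m • ((a′ • x) ⊕ (b′ • y)))) ≈₄ (((l * a + m * a′) • x) ⊕ ((l * b + m * b′) • y))
  •⊕-collect l m a b a′ b′ (x₀ , x₁ , x₂ , x₃) (y₀ , y₁ , y₂ , y₃) =
    collect x₀ y₀ , collect x₁ y₁ , collect x₂ y₂ , collect x₃ y₃
    where
    collect : ∀ x y → l * (a * x + b * y) + m * (a′ * x + b′ * y) ≈ (l * a + m * a′) * x + (l * b + m * b′) * y
    collect x y = solve 8 (λ l m a b a′ b′ x y → l :* (a :* x :+ b :* y) :+ m :* (a′ :* x :+ b′ :* y)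
                                                 := (l :* a :+ m :* a′) :* x :+ (l :* b :+ m :* b′) :* y)
                    refl l m a b a′ b′ x y

module BaerSubgeometry {c ℓ} (F : CommutativeRing c ℓ) (q : ℕ) (isField : IsFieldCR F)
                       (_≟_ : Decidable (CommutativeRing._≈_ F))
                       (frob-involution : IsNontrivialInvolution F (Geometry.frob F q)) where
  open CommutativeRing F hiding (zero)
  open Geometry F q
  open IntegerCoefficientSolver F
  open LinearCombination F
  open FieldProperties F isField
  open Conjugation F isField _≟_ frob-involution
  open import Algebra.Properties.Ring ring using (-‿involutive; -0#≈0#)
  open VectorAlgebra F q
  open import Relation.Binary.Reasoning.Setoid setoid

  σvec≈𝟎 : ∀ {a b} → a ≈ 0# → b ≈ 0# → σvec a b ≈₄ 𝟎
  σvec≈𝟎 a≈0 b≈0 = a≈0 , b≈0 , trans (frob-cong b≈0) frob-0 , trans (frob-cong a≈0) frob-0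

  multiple-of-σvec-InΣ : ∀ {P k a b} → NonZeroV P → P ≈₄ (k • σvec a b) → InΣ P
  multiple-of-σvec-InΣ {k = k} {a} {b} P≢𝟎 P≈kσ = a , b , ab≢0 , k , k≉0 , P≈kσ
    where
    ab≢0 : ¬ (a ≈ 0# × b ≈ 0#)
    ab≢0 (a≈0 , b≈0) = P≢𝟎 (≈₄-trans P≈kσ (•-zeroʳ k (σvec≈𝟎 a≈0 b≈0)))
    k≉0 : ¬ k ≈ 0#
    k≉0 k≈0 = P≢𝟎 (≈₄-trans P≈kσ (•-zeroˡ (σvec a b) k≈0))

  σvec-InΣ : ∀ {a b} → NonZeroV (σvec a b) → InΣ (σvec a b)
  σvec-InΣ σ≢𝟎 = multiple-of-σvec-InΣ σ≢𝟎 (sym (*-identityˡ _) , sym (*-identityˡ _) , sym (*-identityˡ _) , sym (*-identityˡ _))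

  a≉0⇒σvec-InΣ : ∀ {a b} → ¬ a ≈ 0# → InΣ (σvec a b)
  a≉0⇒σvec-InΣ a≉0 = σvec-InΣ (a≉0 ∘ proj₁)

  InΣ⇒NonZeroV : ∀ {z} → InΣ z → NonZeroV z
  InΣ⇒NonZeroV (a , b , ab≢0 , ρ , ρ≉0 , z≈) (e₀ , e₁ , _) =
    ab≢0 (x*y≈0⇒y≈0 ρ≉0 (trans (sym (proj₁ z≈)) e₀) , x*y≈0⇒y≈0 ρ≉0 (trans (sym (proj₁ (proj₂ z≈))) e₁))

  Indep2⇒NonZeroVˡ : ∀ {x y} → Indep2 x y → NonZeroV x
  Indep2⇒NonZeroVˡ {x} {y} indep (e₀ , e₁ , e₂ , e₃) =
    1≉0 (proj₁ (indep 1# 0# (component e₀ , component e₁ , component e₂ , component e₃)))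
    where
    component : ∀ {xᵢ yᵢ} → xᵢ ≈ 0# → 1# * xᵢ + 0# * yᵢ ≈ 0#
    component xᵢ≈0 = trans (+-cong (*-identityˡ _) (zeroˡ _)) (trans (+-identityʳ _) xᵢ≈0)

  Indep2⇒NonZeroVʳ : ∀ {x y} → Indep2 x y → NonZeroV y
  Indep2⇒NonZeroVʳ {x} {y} indep (e₀ , e₁ , e₂ , e₃) =
    1≉0 (proj₂ (indep 0# 1# (component e₀ , component e₁ , component e₂ , component e₃)))
    where
    component : ∀ {xᵢ yᵢ} → yᵢ ≈ 0# → 0# * xᵢ + 1# * yᵢ ≈ 0#
    component yᵢ≈0 = trans (+-cong (zeroˡ _) (*-identityˡ _)) (trans (+-identityˡ _) yᵢ≈0)

  Indep2-subst : ∀ {x y u v λ′ μ′} → Indep2 u v → x ≈₄ (λ′ • u) → y ≈₄ (μ′ • v) →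
                 ¬ λ′ ≈ 0# → ¬ μ′ ≈ 0# → Indep2 x y
  Indep2-subst {λ′ = λ′} {μ′} indep x≈ y≈ λ′≉0 μ′≉0 l m lx+my≈𝟎 =
    let (l′≈0 , m′≈0) = indep (l * λ′) (m * μ′) (≈₄-trans (≈₄-sym (•⊕-subst l m x≈ y≈)) lx+my≈𝟎)
    in x*y≈0⇒x≈0 λ′≉0 l′≈0 , x*y≈0⇒x≈0 μ′≉0 m′≈0

  InSpan2-subst : ∀ {z x y u v λ′ μ′} → InSpan2 z x y → x ≈₄ (λ′ • u) → y ≈₄ (μ′ • v) → InSpan2 z u v
  InSpan2-subst {λ′ = λ′} {μ′} (l , m , z≈) x≈ y≈ = l * λ′ , m * μ′ , ≈₄-trans z≈ (•⊕-subst l m x≈ y≈)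

  fixed-combination-σvec : ∀ {p r} → Fixed p → Fixed r → ∀ a₁ b₁ a₂ b₂ →
    ((p • σvec a₁ b₁) ⊕ (r • σvec a₂ b₂)) ≈₄ σvec (p * a₁ + r * a₂) (p * b₁ + r * b₂)
  fixed-combination-σvec p-fixed r-fixed a₁ b₁ a₂ b₂ =
    refl , refl , sym (frob-fixed-*+* p-fixed r-fixed b₁ b₂) , sym (frob-fixed-*+* p-fixed r-fixed a₁ a₂)

  Bf-σvec-fixed : ∀ c d a b → Fixed (Bf (σvec c d) (σvec a b))
  Bf-σvec-fixed c d a b = begin
    frob (((c * frob a + frob c * a) - d * frob b) - frob d * b)
      ≈⟨ frob-sub _ _ ⟩
    frob ((c * frob a + frob c * a) - d * frob b) - frob (frob d * b)
      ≈⟨ +-cong (frob-sub _ _) (-‿cong (frob-* _ _)) ⟩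
    (frob (c * frob a + frob c * a) - frob (d * frob b)) - frob (frob d) * frob b
      ≈⟨ +-cong (+-cong (frob-*+* _ _ _ _) (-‿cong (frob-* _ _))) (-‿cong (*-congʳ (frob-involutive d))) ⟩
    ((frob c * frob (frob a) + frob (frob c) * frob a) - frob d * frob (frob b)) - d * frob b
      ≈⟨ +-congʳ (+-cong (+-cong (*-congˡ (frob-involutive a)) (*-congʳ (frob-involutive c))) (-‿cong (*-congˡ (frob-involutive b)))) ⟩
    ((frob c * a + c * frob a) - frob d * b) - d * frob b
      ≈⟨ solve 8 (λ c c′ a a′ d d′ b b′ → ((c′ :* a :+ c :* a′) :- d′ :* b) :- d :* b′ := ((c :* a′ :+ c′ :* a) :- d :* b′) :- d′ :* b)
           refl c (frob c) a (frob a) d (frob d) b (frob b) ⟩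
    ((c * frob a + frob c * a) - d * frob b) - frob d * b
      ∎

  Qf-•σvec : ∀ ρ a b → Qf (ρ • σvec a b) ≈ (ρ * ρ) * (norm a - norm b)
  Qf-•σvec ρ a b = solve 5 (λ ρ a b a′ b′ → (ρ :* a) :* (ρ :* a′) :- (ρ :* b) :* (ρ :* b′) := (ρ :* ρ) :* (a :* a′ :- b :* b′))
    refl ρ a b (frob a) (frob b)

  OnQ0⇒norm≈norm : ∀ {r ρ c d} → ¬ ρ ≈ 0# → r ≈₄ (ρ • σvec c d) → Qf r ≈ 0# → norm c ≈ norm d
  OnQ0⇒norm≈norm {r} {ρ} {c} {d} ρ≉0 r≈ρσ Qr≈0 = x-y≈0⇒x≈y _ _ (x*y≈0⇒y≈0 (*-≉0 ρ≉0 ρ≉0)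
    (trans (sym (Qf-•σvec ρ c d)) (trans (sym (Qf-cong r≈ρσ)) Qr≈0)))

  norm≈norm⇒≉0 : ∀ {c d} → norm c ≈ norm d → ¬ (c ≈ 0# × d ≈ 0#) → ¬ c ≈ 0# × ¬ d ≈ 0#
  norm≈norm⇒≉0 {c} {d} Nc≈Nd cd≢0 with c ≟ 0# | d ≟ 0#
  ... | yes c≈0 | yes d≈0 = ⊥-elim (cd≢0 (c≈0 , d≈0))
  ... | yes c≈0 | no d≉0  = ⊥-elim (*-≉0 d≉0 (frob-≉0 d≉0) (trans (sym Nc≈Nd) (trans (*-congʳ c≈0) (zeroˡ _))))
  ... | no c≉0  | yes d≈0 = ⊥-elim (*-≉0 c≉0 (frob-≉0 c≉0) (trans Nc≈Nd (trans (*-congʳ d≈0) (zeroˡ _))))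
  ... | no c≉0  | no d≉0  = c≉0 , d≉0

  norm-transfer : ∀ {c d x y} → norm c ≈ norm d → ¬ c ≈ 0# → c * y ≈ d * x → norm x ≈ norm y
  norm-transfer {c} {d} {x} {y} Nc≈Nd c≉0 cy≈dx = x-y≈0⇒x≈y _ _ (x*y≈0⇒y≈0 (*-≉0 c≉0 (frob-≉0 c≉0))
    (x≈y+z⇒z≈0⇒x≈y
      (solve 8 (λ c c′ d d′ x x′ y y′ → c :* c′ :* (x :* x′ :- y :* y′) :=
                con (+ 0) :+ ((:- (c′ :* y′)) :* (c :* y :- d :* x) :+ (:- (d :* x)) :* (c′ :* y′ :- d′ :* x′) :+ (x :* x′) :* (c :* c′ :- d :* d′)))
        refl c (frob c) d (frob d) x (frob x) y (frob y))
      (+-vanish (+-vanish (*-vanish _ (x≈y⇒x-y≈0 cy≈dx))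
                          (*-vanish _ (x≈y⇒x-y≈0 (trans (sym (frob-* c y)) (trans (frob-cong cy≈dx) (frob-* d x))))))
                (*-vanish _ (x≈y⇒x-y≈0 Nc≈Nd)))))

  orthogonal⇒proportional : ∀ {s t A M} → A * s + M * t ≈ 0# → ¬ (s ≈ 0# × t ≈ 0#) →
                            ∃[ k ] (∀ x y → A * x + M * y ≈ k * (t * x + (- s) * y))
  orthogonal⇒proportional {s} {t} {A} {M} As+Mt≈0 st≢0 with s ≟ 0# | t ≟ 0#
  ... | yes s≈0 | yes t≈0 = ⊥-elim (st≢0 (s≈0 , t≈0))
  ... | no s≉0  | _       = - (M * s⁻¹) , λ x y → x≈y+z⇒z≈0⇒x≈y
      (solve 7 (λ s t A M s⁻¹ x y → A :* x :+ M :* y :=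
         (:- (M :* s⁻¹)) :* (t :* x :+ (:- s) :* y) :+ ((x :* s⁻¹) :* (A :* s :+ M :* t) :+ (:- (A :* x :+ M :* y)) :* (s :* s⁻¹ :- con (+ 1))))
         refl s t A M s⁻¹ x y)
      (+-vanish (*-vanish _ As+Mt≈0) (*-vanish _ (x≈y⇒x-y≈0 (proj₂ (inverse s s≉0)))))
    where s⁻¹ = proj₁ (inverse s s≉0)
  ... | yes _   | no t≉0  = A * t⁻¹ , λ x y → x≈y+z⇒z≈0⇒x≈y
      (solve 7 (λ s t A M t⁻¹ x y → A :* x :+ M :* y :=
         (A :* t⁻¹) :* (t :* x :+ (:- s) :* y) :+ ((y :* t⁻¹) :* (A :* s :+ M :* t) :+ (:- (A :* x :+ M :* y)) :* (t :* t⁻¹ :- con (+ 1))))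
         refl s t A M t⁻¹ x y)
      (+-vanish (*-vanish _ As+Mt≈0) (*-vanish _ (x≈y⇒x-y≈0 (proj₂ (inverse t t≉0)))))
    where t⁻¹ = proj₁ (inverse t t≉0)

  orthogonal-fixed-pair⇒InΣ : ∀ {P A M s t a₁ b₁ a₂ b₂} → NonZeroV P →
    P ≈₄ ((A • σvec a₁ b₁) ⊕ (M • σvec a₂ b₂)) → Fixed s → Fixed t → ¬ (s ≈ 0# × t ≈ 0#) →
    A * s + M * t ≈ 0# → InΣ P
  orthogonal-fixed-pair⇒InΣ {a₁ = a₁} {b₁} {a₂} {b₂} P≢𝟎 P≈ s-fixed t-fixed st≢0 As+Mt≈0 =
    let (k , proportional) = orthogonal⇒proportional As+Mt≈0 st≢0
    in multiple-of-σvec-InΣ P≢𝟎 (≈₄-trans P≈ (≈₄-trans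
         (proportional a₁ a₂ , proportional b₁ b₂ , proportional (frob b₁) (frob b₂) , proportional (frob a₁) (frob a₂))
         (•-congʳ k (fixed-combination-σvec t-fixed (fixed-neg s-fixed) a₁ b₁ a₂ b₂))))

  Bf-σvec-scaled : ∀ c d θ φ → Bf (σvec c d) (σvec (θ * c) (φ * d)) ≈ norm c * (θ + frob θ) - norm d * (φ + frob φ)
  Bf-σvec-scaled c d θ φ = trans
    (+-congʳ (+-cong (+-congʳ (*-congˡ (frob-* θ c))) (-‿cong (*-congˡ (frob-* φ d)))))
    (solve 8 (λ c c′ d d′ t t′ f f′ → ((c :* (t′ :* c′) :+ c′ :* (t :* c)) :- d :* (f′ :* d′)) :- d′ :* (f :* d)
                                      := c :* c′ :* (t :+ t′) :- d :* d′ :* (f :+ f′))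
      refl c (frob c) d (frob d) θ (frob θ) φ (frob φ))

  Bf-scaled-σvec : ∀ θ c d a b → Bf (σvec (θ * c) (θ * d)) (σvec a b) ≈ θ * (c * frob a - d * frob b) + frob (θ * (c * frob a - d * frob b))
  Bf-scaled-σvec θ c d a b = trans
    (+-cong (+-congʳ (+-congˡ (*-congʳ (frob-* θ c)))) (-‿cong (*-congʳ (frob-* θ d))))
    (trans
      (solve 10 (λ t t′ c c′ d d′ a a′ b b′ → ((t :* c :* a′ :+ t′ :* c′ :* a) :- t :* d :* b′) :- t′ :* d′ :* b
                                             := t :* (c :* a′ :- d :* b′) :+ t′ :* (c′ :* a :- d′ :* b))
        refl θ (frob θ) c (frob c) d (frob d) a (frob a) b (frob b))
      (+-congˡ (sym (trans (frob-* θ _) (*-congˡ (trans (frob-sub _ _) (+-cong (trans (frob-* c _) (*-congˡ (frob-involutive a)))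
                                                                              (-‿cong (trans (frob-* d _) (*-congˡ (frob-involutive b)))))))))))

  norm-* : ∀ x y → norm (x * y) ≈ norm x * norm y
  norm-* x y = trans (*-congˡ (frob-* x y)) (solve 4 (λ x y x′ y′ → x :* y :* (x′ :* y′) := x :* x′ :* (y :* y′)) refl x y (frob x) (frob y))

  factor-coordinates : ∀ α β γ u v z → α * z + β * (u * z) + γ * (v * z) ≈ (α + u * β + v * γ) * z
  factor-coordinates α β γ u v z = solve 6 (λ a b g u v z → a :* z :+ b :* (u :* z) :+ g :* (v :* z) := (a :+ u :* b :+ v :* g) :* z) refl α β γ u v z

  module Tangency {c d} (c≉0 : ¬ c ≈ 0#) (d≉0 : ¬ d ≈ 0#) (Nc≈Nd : norm c ≈ norm d) where
    cross : Carrier → Carrier → Carrier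
    cross a b = c * b - d * a

    frob-cross : ∀ a b → frob (cross a b) ≈ frob c * frob b - frob d * frob a
    frob-cross a b = trans (frob-sub _ _) (+-cong (frob-* c b) (-‿cong (frob-* d a)))

    tangent⇒cross-relation : ∀ {a b} → Bf (σvec c d) (σvec a b) ≈ 0# →
                             c * d * frob (cross a b) + frob c * frob d * cross a b ≈ 0#
    tangent⇒cross-relation {a} {b} tangent = trans (+-congʳ (*-congˡ (frob-cross a b))) (x≈y+z⇒z≈0⇒x≈y
      (solve 8 (λ c c′ d d′ a a′ b b′ →
         c :* d :* (c′ :* b′ :- d′ :* a′) :+ c′ :* d′ :* (c :* b :- d :* a) :=
         con (+ 0) :+ ((:- (c :* c′)) :* (((c :* a′ :+ c′ :* a) :- d :* b′) :- d′ :* b) :+ (c :* a′ :+ c′ :* a) :* (c :* c′ :- d :* d′)))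
        refl c (frob c) d (frob d) a (frob a) b (frob b))
      (+-vanish (*-vanish _ tangent) (*-vanish _ (x≈y⇒x-y≈0 Nc≈Nd))))

    -- Tangency fixes the ratio frob (cross a b) / cross a b, whence the two products agree.
    cross-frob-symmetric : ∀ {a₁ b₁ a₂ b₂} → Bf (σvec c d) (σvec a₁ b₁) ≈ 0# → Bf (σvec c d) (σvec a₂ b₂) ≈ 0# →
                           cross a₁ b₁ * frob (cross a₂ b₂) ≈ frob (cross a₁ b₁) * cross a₂ b₂
    cross-frob-symmetric {a₁} {b₁} {a₂} {b₂} tangent₁ tangent₂ =
      x-y≈0⇒x≈y _ _ (x*y≈0⇒y≈0 (*-≉0 c≉0 d≉0) (x≈y+z⇒z≈0⇒x≈y
        (solve 6 (λ cd c′d′ E E′ G G′ → cd :* (E :* G′ :- E′ :* G) :=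
           con (+ 0) :+ (E :* (cd :* G′ :+ c′d′ :* G) :+ (:- G) :* (cd :* E′ :+ c′d′ :* E)))
          refl (c * d) (frob c * frob d) (cross a₁ b₁) (frob (cross a₁ b₁)) (cross a₂ b₂) (frob (cross a₂ b₂)))
        (+-vanish (*-vanish _ (tangent⇒cross-relation tangent₂)) (*-vanish _ (tangent⇒cross-relation tangent₁)))))

    line-in-tangent-plane-meets-Q0 : ∀ {a₁ b₁ a₂ b₂} → Indep2 (σvec a₁ b₁) (σvec a₂ b₂) →
      Bf (σvec c d) (σvec a₁ b₁) ≈ 0# → Bf (σvec c d) (σvec a₂ b₂) ≈ 0# →
      ∃[ z ] (InΣ z × InSpan2 z (σvec a₁ b₁) (σvec a₂ b₂) × OnQ0 z)
    line-in-tangent-plane-meets-Q0 {a₁} {b₁} {a₂} {b₂} indep tangent₁ tangent₂ with cross a₁ b₁ ≟ 0#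
    ... | yes E≈0 = σvec a₁ b₁ , σ₁∈Σ , (1# , 0# , σ₁≈) , σ₁∈Σ ,
                    x≈y⇒x-y≈0 (norm-transfer Nc≈Nd c≉0 (x-y≈0⇒x≈y _ _ E≈0))
      where
      σ₁∈Σ = σvec-InΣ (Indep2⇒NonZeroVˡ indep)
      σ₁≈ : σvec a₁ b₁ ≈₄ ((1# • σvec a₁ b₁) ⊕ (0# • σvec a₂ b₂))
      σ₁≈ = component , component , component , component
        where
        component : ∀ {x y} → x ≈ 1# * x + 0# * y
        component = sym (trans (+-cong (*-identityˡ _) (zeroˡ _)) (+-identityʳ _))
    ... | no E≉0 = z , z∈Σ , (α′ , β′ , ≈₄-sym z≈) , z∈Σ , x≈y⇒x-y≈0 (norm-transfer Nc≈Nd c≉0 cY≈dX)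
      where
      -- α′ and β′ are fixed and make c Y = d X: z is where the line meets the generator of Q0 through σvec c d.
      E = cross a₁ b₁
      G = cross a₂ b₂
      α′ = frob E * G
      β′ = - (E * frob E)
      X = α′ * a₁ + β′ * a₂
      Y = α′ * b₁ + β′ * b₂
      z = σvec X Y
      α′-fixed : Fixed α′
      α′-fixed = trans (frob-* (frob E) G) (trans (*-congʳ (frob-involutive E)) (cross-frob-symmetric tangent₁ tangent₂))
      z≈ : ((α′ • σvec a₁ b₁) ⊕ (β′ • σvec a₂ b₂)) ≈₄ z
      z≈ = fixed-combination-σvec α′-fixed (fixed-neg (frob-norm E)) a₁ b₁ a₂ b₂
      z∈Σ : InΣ z
      z∈Σ = σvec-InΣ λ z≈𝟎 → E≉0 (x*y≈0⇒x≈0 (frob-≉0 E≉0) (trans (sym (-‿involutive _))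
        (trans (-‿cong (proj₂ (indep α′ β′ (≈₄-trans z≈ z≈𝟎)))) -0#≈0#)))
      cY≈dX : c * Y ≈ d * X
      cY≈dX = solve 7 (λ c d a₁ b₁ a₂ b₂ E′ →
        c :* (E′ :* (c :* b₂ :- d :* a₂) :* b₁ :+ (:- ((c :* b₁ :- d :* a₁) :* E′)) :* b₂) :=
        d :* (E′ :* (c :* b₂ :- d :* a₂) :* a₁ :+ (:- ((c :* b₁ :- d :* a₁) :* E′)) :* a₂))
        refl c d a₁ b₁ a₂ b₂ (frob E)

    -- In the coordinates A = a / c, B = b / d of σvec a b, tangency at σvec c d reads A + Ā = B + B̄;
    -- the τᵢ, with coordinates (1 , 1), (ε , ε) and (ε , ε̄), span its solutions.
    τ₁ τ₂ τ₃ : V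
    τ₁ = σvec c d
    τ₂ = σvec (ε * c) (ε * d)
    τ₃ = σvec (ε * c) (frob ε * d)

    tangent-scaled : ∀ {θ φ} → θ + frob θ ≈ φ + frob φ → Bf (σvec c d) (σvec (θ * c) (φ * d)) ≈ 0#
    tangent-scaled {θ} {φ} traces≈ = trans (Bf-σvec-scaled c d θ φ)
      (trans (+-congˡ (-‿cong (*-cong (sym Nc≈Nd) (sym traces≈)))) (-‿inverseʳ _))

    tangent-τ₁ : Bf (σvec c d) τ₁ ≈ 0#
    tangent-τ₁ = x≈y+z⇒z≈0⇒x≈y
      (solve 4 (λ c c′ d d′ → ((c :* c′ :+ c′ :* c) :- d :* d′) :- d′ :* d := con (+ 0) :+ (con (+ 2)) :* (c :* c′ :- d :* d′))
        refl c (frob c) d (frob d))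
      (*-vanish _ (x≈y⇒x-y≈0 Nc≈Nd))

    tangent-τ₂ : Bf (σvec c d) τ₂ ≈ 0#
    tangent-τ₂ = tangent-scaled refl

    tangent-τ₃ : Bf (σvec c d) τ₃ ≈ 0#
    tangent-τ₃ = tangent-scaled (trans (+-comm ε (frob ε)) (+-congˡ (sym (frob-involutive ε))))

    frob-frobε* : ∀ x → frob (frob ε * x) ≈ ε * frob x
    frob-frobε* x = trans (frob-* (frob ε) x) (*-congʳ (frob-involutive ε))

    τ-independent : Indep3 τ₁ τ₂ τ₃
    τ-independent α β γ (e₀ , e₁ , e₂ , _) = trace-coordinates-injective
      (x*y≈0⇒x≈0 c≉0 (trans (sym (factor-coordinates α β γ ε ε c)) e₀))
      (x*y≈0⇒x≈0 d≉0 (trans (sym (factor-coordinates α β γ ε (frob ε) d)) e₁))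
      (x*y≈0⇒x≈0 (frob-≉0 d≉0) (trans (sym (factor-coordinates α β γ (frob ε) ε (frob d)))
        (trans (+-cong (+-congˡ (*-congˡ (sym (frob-* ε d)))) (*-congˡ (sym (frob-frobε* d)))) e₂)))

    τ-coordinates : ∀ {a b} → Bf (σvec c d) (σvec a b) ≈ 0# →
                    ∃[ α ] ∃[ β ] ∃[ γ ] (σvec a b ≈₄ (((α • τ₁) ⊕ (β • τ₂)) ⊕ (γ • τ₃)))
    τ-coordinates {a} {b} tangent =
      let (α , β , γ , L₁ , L₂ , L₃ , L₄) = trace-coordinates traces≈
      in α , β , γ ,
         (trans a≈Ac (sym (trans (factor-coordinates α β γ ε ε c) (*-congʳ L₁)))) ,
         (trans b≈Bd (sym (trans (factor-coordinates α β γ ε (frob ε) d) (*-congʳ L₂)))) ,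
         (trans (trans (frob-cong b≈Bd) (frob-* B d))
           (sym (trans (+-cong (+-congˡ (*-congˡ (frob-* ε d))) (*-congˡ (frob-frobε* d)))
                       (trans (factor-coordinates α β γ (frob ε) ε (frob d)) (*-congʳ L₃))))) ,
         (trans (trans (frob-cong a≈Ac) (frob-* A c))
           (sym (trans (+-cong (+-congˡ (*-congˡ (frob-* ε c))) (*-congˡ (frob-* ε c)))
                       (trans (factor-coordinates α β γ (frob ε) (frob ε) (frob c)) (*-congʳ L₄)))))
      where
      A = proj₁ (inverse c c≉0) * a
      B = proj₁ (inverse d d≉0) * b
      a≈Ac : a ≈ A * c
      a≈Ac = trans (sym (x*y≈1⇒x*[y*z]≈z (proj₂ (inverse c c≉0)) a)) (*-comm c A)
      b≈Bd : b ≈ B * d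
      b≈Bd = trans (sym (x*y≈1⇒x*[y*z]≈z (proj₂ (inverse d d≉0)) b)) (*-comm d B)
      traces≈ : A + frob A ≈ B + frob B
      traces≈ = x-y≈0⇒x≈y _ _ (x*y≈0⇒y≈0 (*-≉0 c≉0 (frob-≉0 c≉0)) (begin
        norm c * ((A + frob A) - (B + frob B))               ≈⟨ solve 3 (λ n s t → n :* (s :- t) := n :* s :- n :* t) refl (norm c) _ _ ⟩
        norm c * (A + frob A) - norm c * (B + frob B)        ≈⟨ +-congˡ (-‿cong (*-congʳ Nc≈Nd)) ⟩
        norm c * (A + frob A) - norm d * (B + frob B)        ≈⟨ Bf-σvec-scaled c d A B ⟨
        Bf (σvec c d) (σvec (A * c) (B * d))                 ≈⟨ Bf-congʳ (σvec c d) (a≈Ac , b≈Bd , frob-cong b≈Bd , frob-cong a≈Ac) ⟨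
        Bf (σvec c d) (σvec a b)                             ≈⟨ tangent ⟩
        0#                                                   ∎))

    span-in-tangent-plane : ∀ {P a₁ b₁ a₂ b₂ k k′} → Bf (σvec c d) (σvec a₁ b₁) ≈ 0# → Bf (σvec c d) (σvec a₂ b₂) ≈ 0# →
                            P ≈₄ ((k • σvec a₁ b₁) ⊕ (k′ • σvec a₂ b₂)) → OnExtTangentPlane P
    span-in-tangent-plane {k = k} {k′} tangent₁ tangent₂ (e₀ , e₁ , e₂ , e₃) =
      let (α₁ , β₁ , γ₁ , f₀ , f₁ , f₂ , f₃) = τ-coordinates tangent₁
          (α₂ , β₂ , γ₂ , g₀ , g₁ , g₂ , g₃) = τ-coordinates tangent₂
      in σvec c d , (a≉0⇒σvec-InΣ c≉0 , x≈y⇒x-y≈0 Nc≈Nd) , τ₁ , τ₂ , τ₃ ,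
         (a≉0⇒σvec-InΣ c≉0 , tangent-τ₁) ,
         (a≉0⇒σvec-InΣ (*-≉0 ε≉0 c≉0) , tangent-τ₂) ,
         (a≉0⇒σvec-InΣ (*-≉0 ε≉0 c≉0) , tangent-τ₃) ,
         τ-independent ,
         (k * α₁ + k′ * α₂ , k * β₁ + k′ * β₂ , k * γ₁ + k′ * γ₂ ,
          combine e₀ f₀ g₀ , combine e₁ f₁ g₁ , combine e₂ f₂ g₂ , combine e₃ f₃ g₃)
      where
      combine : ∀ {p u v a₁ b₁ c₁ a₂ b₂ c₂ x y w} → p ≈ k * u + k′ * v →
                u ≈ a₁ * x + b₁ * y + c₁ * w → v ≈ a₂ * x + b₂ * y + c₂ * w →
                p ≈ (k * a₁ + k′ * a₂) * x + (k * b₁ + k′ * b₂) * y + (k * c₁ + k′ * c₂) * w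
      combine {a₁ = a₁} {b₁} {c₁} {a₂} {b₂} {c₂} {x} {y} {w} p≈ u≈ v≈ = trans p≈ (trans (+-cong (*-congˡ u≈) (*-congˡ v≈))
        (solve 11 (λ k k′ a₁ b₁ c₁ a₂ b₂ c₂ x y w →
           k :* (a₁ :* x :+ b₁ :* y :+ c₁ :* w) :+ k′ :* (a₂ :* x :+ b₂ :* y :+ c₂ :* w)
           := (k :* a₁ :+ k′ :* a₂) :* x :+ (k :* b₁ :+ k′ :* b₂) :* y :+ (k :* c₁ :+ k′ :* c₂) :* w)
          refl k k′ a₁ b₁ c₁ a₂ b₂ c₂ x y w))

  line-through-tangent-point-meets-Q0 : ∀ {P A M a₁ b₁ a₂ b₂ c d} → NonZeroV P → ¬ InΣ P →
    P ≈₄ ((A • σvec a₁ b₁) ⊕ (M • σvec a₂ b₂)) → Indep2 (σvec a₁ b₁) (σvec a₂ b₂) →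
    ¬ (c ≈ 0# × d ≈ 0#) → norm c ≈ norm d → Bf (σvec c d) P ≈ 0# →
    ∃[ z ] (InΣ z × InSpan2 z (σvec a₁ b₁) (σvec a₂ b₂) × OnQ0 z)
  line-through-tangent-point-meets-Q0 {P} {A} {M} {a₁} {b₁} {a₂} {b₂} {c} {d} P≢𝟎 P∉Σ P≈ indep cd≢0 Nc≈Nd tangent
    with (Bf (σvec c d) (σvec a₁ b₁) ≟ 0#) ×-dec (Bf (σvec c d) (σvec a₂ b₂) ≟ 0#)
  ... | yes (s≈0 , t≈0) = Tangency.line-in-tangent-plane-meets-Q0 c≉0 d≉0 Nc≈Nd indep s≈0 t≈0
    where
    c≉0 = proj₁ (norm≈norm⇒≉0 Nc≈Nd cd≢0)
    d≉0 = proj₂ (norm≈norm⇒≉0 Nc≈Nd cd≢0)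
  ... | no st≢0 = ⊥-elim (P∉Σ (orthogonal-fixed-pair⇒InΣ P≢𝟎 P≈
                    (Bf-σvec-fixed c d a₁ b₁) (Bf-σvec-fixed c d a₂ b₂) st≢0 As+Mt≈0))
    where
    As+Mt≈0 = trans (sym (Bf-linear₂ (σvec c d) A M _ _)) (trans (sym (Bf-congʳ _ P≈)) tangent)

  external⇒¬tangent : ∀ P → NonZeroV P → ¬ InΣ P → OnExtExternalLine P → ¬ OnExtTangentPlane P
  external⇒¬tangent P P≢𝟎 P∉Σ
    (u , v , (a₁ , b₁ , _ , λ′ , λ′≉0 , u≈) , (a₂ , b₂ , _ , μ′ , μ′≉0 , v≈) , indep , (l , m , P≈) , external)
    (r , ((c , d , cd≢0 , ρ , ρ≉0 , r≈) , Qr≈0) , x , y , w , (_ , rx≈0) , (_ , ry≈0) , (_ , rw≈0) , _ , (α , β , γ , P≈′)) =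
    let (z , z∈Σ , z∈span , z∈Q0) = line-through-tangent-point-meets-Q0 P≢𝟎 P∉Σ (≈₄-trans P≈ (•⊕-subst l m u≈ v≈))
          (Indep2-subst indep σ₁≈ σ₂≈ (x*y≈1⇒y≉0 λλ⁻¹≈1) (x*y≈1⇒y≉0 μμ⁻¹≈1))
          cd≢0 (OnQ0⇒norm≈norm ρ≉0 r≈ Qr≈0) tangent
    in external z z∈Σ (InSpan2-subst z∈span σ₁≈ σ₂≈) z∈Q0
    where
    λλ⁻¹≈1 = proj₂ (inverse λ′ λ′≉0)
    μμ⁻¹≈1 = proj₂ (inverse μ′ μ′≉0)
    σ₁≈ = •-invert λλ⁻¹≈1 u≈
    σ₂≈ = •-invert μμ⁻¹≈1 v≈
    tangent : Bf (σvec c d) P ≈ 0#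
    tangent = x*y≈0⇒y≈0 ρ≉0 (begin
      ρ * Bf (σvec c d) P                       ≈⟨ Bf-scaleˡ ρ (σvec c d) P ⟨
      Bf (ρ • σvec c d) P                       ≈⟨ Bf-congˡ P r≈ ⟨
      Bf r P                                    ≈⟨ Bf-congʳ r P≈′ ⟩
      Bf r (((α • x) ⊕ (β • y)) ⊕ (γ • w))      ≈⟨ Bf-linear₃ r α β γ x y w ⟩
      α * Bf r x + β * Bf r y + γ * Bf r w      ≈⟨ +-vanish (+-vanish (*-vanish α rx≈0) (*-vanish β ry≈0)) (*-vanish γ rw≈0) ⟩
      0#                                        ∎)

  CommonTangentPlane : V → V → Set (c ⊔ ℓ)
  CommonTangentPlane x y =
    ∃[ a ] ∃[ b ] (¬ a ≈ 0# × ¬ b ≈ 0# × norm a ≈ norm b × Bf (σvec a b) x ≈ 0# × Bf (σvec a b) y ≈ 0#)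

  line-meeting-Q0-lies-in-tangent-plane : ∀ {a₁ b₁ a₂ b₂ z} → InSpan2 z (σvec a₁ b₁) (σvec a₂ b₂) → OnQ0 z →
    CommonTangentPlane (σvec a₁ b₁) (σvec a₂ b₂)
  line-meeting-Q0-lies-in-tangent-plane {a₁} {b₁} {a₂} {b₂} {z} (l , m , z≈) (z∈Σ@(c , d , cd≢0 , ρ , ρ≉0 , z≈ρσ) , Qz≈0) =
    by-cases (m ≟ 0#)
    where
    Nc≈Nd = OnQ0⇒norm≈norm ρ≉0 z≈ρσ Qz≈0
    c≉0 = proj₁ (norm≈norm⇒≉0 Nc≈Nd cd≢0)
    d≉0 = proj₂ (norm≈norm⇒≉0 Nc≈Nd cd≢0)

    r : Carrier → V
    r θ = σvec (θ * c) (θ * d)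

    tangent-at : ∀ {θ} → ¬ θ ≈ 0# → Bf (r θ) (σvec a₁ b₁) ≈ 0# → Bf (r θ) (σvec a₂ b₂) ≈ 0# →
      CommonTangentPlane (σvec a₁ b₁) (σvec a₂ b₂)
    tangent-at {θ} θ≉0 tangent₁ tangent₂ = θ * c , θ * d , *-≉0 θ≉0 c≉0 , *-≉0 θ≉0 d≉0 ,
      trans (norm-* θ c) (trans (*-congˡ Nc≈Nd) (sym (norm-* θ d))) , tangent₁ , tangent₂

    -- Every r θ lies on the generator of Q0 through σvec c d, hence is orthogonal to z.
    on-line : ∀ θ → l * Bf (r θ) (σvec a₁ b₁) + m * Bf (r θ) (σvec a₂ b₂) ≈ 0#
    on-line θ = begin
      l * Bf (r θ) (σvec a₁ b₁) + m * Bf (r θ) (σvec a₂ b₂)    ≈⟨ Bf-linear₂ (r θ) l m _ _ ⟨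
      Bf (r θ) ((l • σvec a₁ b₁) ⊕ (m • σvec a₂ b₂))            ≈⟨ Bf-congʳ (r θ) z≈ ⟨
      Bf (r θ) z                                                ≈⟨ Bf-sym (r θ) z ⟩
      Bf z (r θ)                                                ≈⟨ Bf-congˡ (r θ) z≈ρσ ⟩
      Bf (ρ • σvec c d) (r θ)                                   ≈⟨ Bf-scaleˡ ρ (σvec c d) (r θ) ⟩
      ρ * Bf (σvec c d) (r θ)                                   ≈⟨ *-vanish ρ (Tangency.tangent-scaled c≉0 d≉0 Nc≈Nd refl) ⟩
      0#                                                        ∎

    tangent-by-trace : ∀ a b → ∃[ θ ] (¬ θ ≈ 0# × Bf (r θ) (σvec a b) ≈ 0#)
    tangent-by-trace a b =
      let (θ , θ≉0 , trace≈0) = ∃-trace-zero-multiple (c * frob a - d * frob b)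
      in θ , θ≉0 , trans (Bf-scaled-σvec θ c d a b) trace≈0

    by-cases : Dec (m ≈ 0#) → CommonTangentPlane (σvec a₁ b₁) (σvec a₂ b₂)
    by-cases (yes m≈0) =
      let (θ , θ≉0 , tangent₂) = tangent-by-trace a₂ b₂
          l≉0 : ¬ l ≈ 0#
          l≉0 l≈0 = InΣ⇒NonZeroV z∈Σ (≈₄-trans z≈ (•⊕-zero _ _ l≈0 m≈0))
      in tangent-at θ≉0 (x*y≈0⇒y≈0 l≉0 (+-vanishˡ (on-line θ) (*-vanish m tangent₂))) tangent₂
    by-cases (no m≉0) =
      let (θ , θ≉0 , tangent₁) = tangent-by-trace a₁ b₁
      in tangent-at θ≉0 tangent₁ (x*y≈0⇒y≈0 m≉0 (+-vanishʳ (on-line θ) (*-vanish l tangent₁)))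

  conjV : V → V
  conjV (x₀ , x₁ , x₂ , x₃) = frob x₃ , frob x₂ , frob x₁ , frob x₀

  traceV : Carrier → V → V
  traceV θ (p₀ , p₁ , p₂ , p₃) = σvec (θ * p₀ + frob θ * frob p₃) (θ * p₁ + frob θ * frob p₂)

  traceV≈ : ∀ θ P → traceV θ P ≈₄ ((θ • P) ⊕ (frob θ • conjV P))
  traceV≈ θ (p₀ , p₁ , p₂ , p₃) = refl , refl , push p₁ p₂ , push p₀ p₃
    where
    push : ∀ x y → frob (θ * x + frob θ * frob y) ≈ θ * y + frob θ * frob x
    push x y = trans (frob-*+* θ x (frob θ) (frob y))
      (trans (+-comm _ _) (+-congʳ (*-cong (frob-involutive θ) (frob-involutive y))))

  conjV-≈ : ∀ {P κ} → P ≈₄ (κ • conjV P) → conjV P ≈₄ (frob κ • P)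
  conjV-≈ {κ = κ} (e₀ , e₁ , e₂ , e₃) = flip e₃ , flip e₂ , flip e₁ , flip e₀
    where
    flip : ∀ {x y} → x ≈ κ * frob y → frob x ≈ frob κ * y
    flip x≈ = trans (frob-cong x≈) (trans (frob-* κ _) (*-congˡ (frob-involutive _)))

  self-conjugate-trace⇒InΣ : ∀ {P κ} θ → NonZeroV P → P ≈₄ (κ • conjV P) → ¬ θ + frob θ * frob κ ≈ 0# → InΣ P
  self-conjugate-trace⇒InΣ {P} {κ} θ P≢𝟎 P≈κP̄ ζ≉0 = multiple-of-σvec-InΣ P≢𝟎 (•-invert (proj₂ (inverse ζ ζ≉0)) traceV≈ζP)
    where
    ζ = θ + frob θ * frob κ
    collect : ∀ {x} → θ * x + frob θ * (frob κ * x) ≈ ζ * x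
    collect {x} = solve 4 (λ t t′ k′ x → t :* x :+ t′ :* (k′ :* x) := (t :+ t′ :* k′) :* x) refl θ (frob θ) (frob κ) x
    traceV≈ζP : traceV θ P ≈₄ (ζ • P)
    traceV≈ζP = ≈₄-trans (traceV≈ θ P) (≈₄-trans (•⊕-cong θ (frob θ) ≈₄-refl (conjV-≈ P≈κP̄))
      (collect , collect , collect , collect))

  -- Hilbert 90: traceV 1# P or traceV ε P is a nonzero multiple of P.
  self-conjugate⇒InΣ : ∀ {P κ} → NonZeroV P → P ≈₄ (κ • conjV P) → InΣ P
  self-conjugate⇒InΣ {P} {κ} P≢𝟎 P≈κP̄ with (1# + frob κ) ≟ 0#
  ... | no ζ₁≉0  = self-conjugate-trace⇒InΣ 1# P≢𝟎 P≈κP̄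
                     (ζ₁≉0 ∘ trans (+-congˡ (sym (trans (*-congʳ frob-1) (*-identityˡ _)))))
  ... | yes ζ₁≈0 = self-conjugate-trace⇒InΣ ε P≢𝟎 P≈κP̄ λ ζε≈0 → δ≉0 (begin
    δ
      ≈⟨ solve 3 (λ e e′ k′ → e :- e′ := (e :+ e′ :* k′) :- e′ :* (con (+ 1) :+ k′)) refl ε (frob ε) (frob κ) ⟩
    (ε + frob ε * frob κ) - frob ε * (1# + frob κ)
      ≈⟨ +-cong ζε≈0 (-‿cong (*-vanish _ ζ₁≈0)) ⟩
    0# - 0#
      ≈⟨ -‿inverseʳ 0# ⟩
    0#
      ∎)

  conjV≈𝟎⇒≈𝟎 : ∀ {P} → conjV P ≈₄ 𝟎 → P ≈₄ 𝟎
  conjV≈𝟎⇒≈𝟎 (e₀ , e₁ , e₂ , e₃) = frob≈0⇒≈0 e₃ , frob≈0⇒≈0 e₂ , frob≈0⇒≈0 e₁ , frob≈0⇒≈0 e₀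

  Indep2-conjV : ∀ {P} → NonZeroV P → ¬ InΣ P → Indep2 P (conjV P)
  Indep2-conjV {P} P≢𝟎 P∉Σ a b (e₀ , e₁ , e₂ , e₃) with a ≟ 0# | b ≟ 0#
  ... | yes a≈0 | yes b≈0 = a≈0 , b≈0
  ... | yes a≈0 | no b≉0  = ⊥-elim (P≢𝟎 (conjV≈𝟎⇒≈𝟎 (cancel e₀ , cancel e₁ , cancel e₂ , cancel e₃)))
    where
    cancel : ∀ {x y} → a * x + b * y ≈ 0# → y ≈ 0#
    cancel ax+by≈0 = x*y≈0⇒y≈0 b≉0 (+-vanishʳ ax+by≈0 (trans (*-congʳ a≈0) (zeroˡ _)))
  ... | no a≉0  | _       = ⊥-elim (P∉Σ (self-conjugate⇒InΣ P≢𝟎 (solve-for e₀ , solve-for e₁ , solve-for e₂ , solve-for e₃)))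
    where
    a⁻¹ = proj₁ (inverse a a≉0)
    solve-for : ∀ {x y} → a * x + b * y ≈ 0# → x ≈ (- (b * a⁻¹)) * y
    solve-for {x} {y} ax+by≈0 = x≈y+z⇒z≈0⇒x≈y
      (solve 5 (λ a b a⁻¹ x y → x := (:- (b :* a⁻¹)) :* y :+ (a⁻¹ :* (a :* x :+ b :* y) :+ (:- x) :* (a :* a⁻¹ :- con (+ 1))))
        refl a b a⁻¹ x y)
      (+-vanish (*-vanish a⁻¹ ax+by≈0) (*-vanish _ (x≈y⇒x-y≈0 (proj₂ (inverse a a≉0)))))

  module TracePair (P : V) where
    U W : V
    U = traceV 1# P
    W = traceV ε P

    δ⁻¹ = proj₁ (inverse δ δ≉0)
    frob1-1≈0 = x≈y⇒x-y≈0 frob-1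

    combination : ∀ l m → ((l • U) ⊕ (m • W)) ≈₄ (((l * 1# + m * ε) • P) ⊕ ((l * frob 1# + m * frob ε) • conjV P))
    combination l m = ≈₄-trans (•⊕-cong l m (traceV≈ 1# P) (traceV≈ ε P)) (•⊕-collect l m 1# (frob 1#) ε (frob ε) P (conjV P))

    U-W-independent : NonZeroV P → ¬ InΣ P → Indep2 U W
    U-W-independent P≢𝟎 P∉Σ l m lU+mW≈𝟎 = l≈0 , m≈0
      where
      coefficients≈0 = Indep2-conjV P≢𝟎 P∉Σ _ _ (≈₄-trans (≈₄-sym (combination l m)) lU+mW≈𝟎)
      m≈0 : m ≈ 0#
      m≈0 = x*y≈0⇒y≈0 δ≉0 (x≈y+z⇒z≈0⇒x≈y
        (solve 5 (λ l m e e′ o′ → (e :- e′) :* m :=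
           con (+ 0) :+ ((l :* con (+ 1) :+ m :* e) :- (l :* o′ :+ m :* e′) :+ l :* (o′ :- con (+ 1))))
          refl l m ε (frob ε) (frob 1#))
        (+-vanish (trans (+-cong (proj₁ coefficients≈0) (-‿cong (proj₂ coefficients≈0))) (-‿inverseʳ 0#)) (*-vanish l frob1-1≈0)))
      l≈0 : l ≈ 0#
      l≈0 = x≈y+z⇒z≈0⇒x≈y
        (solve 3 (λ l m e → l := con (+ 0) :+ ((l :* con (+ 1) :+ m :* e) :+ (:- e) :* m)) refl l m ε)
        (+-vanish (proj₁ coefficients≈0) (*-vanish _ m≈0))

    -- Solving U = P + P̄ and W = ε P + ε̄ P̄ for P.
    k k′ : Carrier
    k = - (δ⁻¹ * frob ε)
    k′ = δ⁻¹

    P≈kU+k′W : P ≈₄ ((k • U) ⊕ (k′ • W))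
    P≈kU+k′W = ≈₄-sym (≈₄-trans (combination k k′) (unit , unit , unit , unit))
      where
      k+k′ε≈1 : k * 1# + k′ * ε ≈ 1#
      k+k′ε≈1 = x≈y+z⇒z≈0⇒x≈y
        (solve 3 (λ e e′ d⁻¹ → (:- (d⁻¹ :* e′)) :* con (+ 1) :+ d⁻¹ :* e := con (+ 1) :+ ((e :- e′) :* d⁻¹ :- con (+ 1)))
          refl ε (frob ε) δ⁻¹)
        (x≈y⇒x-y≈0 (proj₂ (inverse δ δ≉0)))
      k+k′ε̄≈0 : k * frob 1# + k′ * frob ε ≈ 0#
      k+k′ε̄≈0 = x≈y+z⇒z≈0⇒x≈y
        (solve 3 (λ e′ d⁻¹ o′ → (:- (d⁻¹ :* e′)) :* o′ :+ d⁻¹ :* e′ := con (+ 0) :+ (:- (d⁻¹ :* e′)) :* (o′ :- con (+ 1)))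
          refl (frob ε) δ⁻¹ (frob 1#))
        (*-vanish _ frob1-1≈0)
      unit : ∀ {x y} → (k * 1# + k′ * ε) * x + (k * frob 1# + k′ * frob ε) * y ≈ x
      unit = trans (+-cong (trans (*-congʳ k+k′ε≈1) (*-identityˡ _)) (trans (*-congʳ k+k′ε̄≈0) (zeroˡ _))) (+-identityʳ _)

  ¬tangent⇒external : ∀ P → NonZeroV P → ¬ InΣ P → ¬ OnExtTangentPlane P → OnExtExternalLine P
  ¬tangent⇒external P P≢𝟎 P∉Σ ¬tangent =
    U , W , σvec-InΣ (Indep2⇒NonZeroVˡ indep) , σvec-InΣ (Indep2⇒NonZeroVʳ indep) , indep , (k , k′ , P≈kU+k′W) , external
    where
    open TracePair P
    indep = U-W-independent P≢𝟎 P∉Σ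
    external : ∀ z → InΣ z → InSpan2 z U W → ¬ OnQ0 z
    external z _ z∈span z∈Q0 =
      let (c , d , c≉0 , d≉0 , Nc≈Nd , tangent₁ , tangent₂) = line-meeting-Q0-lies-in-tangent-plane z∈span z∈Q0
      in ¬tangent (Tangency.span-in-tangent-plane c≉0 d≉0 Nc≈Nd tangent₁ tangent₂ P≈kU+k′W)

open import Data.Nat using (_*_)

mainTheorem8 : ∀ {c ℓ} (q : ℕ) → OddPrimePower q →
    (F : CommutativeRing c ℓ) → IsFieldCR F → HasSize F (q * q) →
    (P : Geometry.V F q) → Geometry.NonZeroV F q P → ¬ Geometry.InΣ F q P →
    (Geometry.OnExtExternalLine F q P → ¬ Geometry.OnExtTangentPlane F q P) ×
    (¬ Geometry.OnExtTangentPlane F q P → Geometry.OnExtExternalLine F q P)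
mainTheorem8 q (p , k , p-prime , _ , q≡p^k+1) F isField size P P≢𝟎 P∉Σ =
  external⇒¬tangent P P≢𝟎 P∉Σ , ¬tangent⇒external P P≢𝟎 P∉Σ
  where
  open BaerSubgeometry F q isField (FiniteField._≟_ F isField size)
                       (FrobeniusInvolution.frobenius-involution F isField {k = k} p-prime q≡p^k+1 size)
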